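{- Let $n\geq 2$, $k\geq 1$ and $\alpha\in\mathcal{A}_n$, and write $\mu=\psi(\alpha)\in\mathcal{M}_{n-1}$. Then: (1) $\mathbf{U}(\alpha)=\mathbf{F}(\mu)+\mathbf{U}(\mu)=\mathbf{F}(\mu)+\mathbf{D}(\mu)$; (2) $\mathbf{D}(\alpha)=\mathbf{UD}(\alpha)=\mathbb{1}_{F}(\mu)+\mathbf{UFD}(\mu)+\mathbb{1}_{U\mathcal{M}D}(\mu)+\mathbf{U^2\mathcal{M}D^2}(\mu)$; (3) $\mathbf{DU}(\alpha)=\mathbf{UFD}(\mu)+\mathbf{U^2\mathcal{M}D^2}(\mu)$; (4) $\mathbf{UU}(\alpha)=\mathbf{F}(\mu)-1$; (5) $\mathbf{\Delta_k}(\alpha)=\mathbb{1}_{F^k}(\mu)+\mathbf{UF^kD}(\mu)+\mathbb{1}_{F^{k-1}U\mathcal{M}D}(\mu)+\mathbf{UF^{k-1}U\mathcal{M}D^2}(\mu)$; (6) $\mathbf{Peak}(\alpha)=\mathbf{U}(\mu)+1$; (7) $\mathbf{Ret}(\alpha)=n-\mathbf{LastF}(\mu)$; (8) $\mathbf{SLast}(\alpha)=\mathbf{Ret}(\mu)$.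
   Context: A Dyck path with air pockets is a non-empty lattice path in the first quadrant starting at the origin, ending on the $x$-axis, with steps $U=(1,1)$ and $D_k=(1,-k)$, $k\geq1$, no two down-steps consecutive; $D=D_1$; $\mathcal{A}_n$ is the set of those of length $n$ (number of steps), $\mathcal{A}=\bigcup_{n\ge2}\mathcal{A}_n$. A path is prime if it ends with $D_k$, $k\ge2$, and touches the $x$-axis only at its endpoints; $\mathcal{P}$ is the set of prime paths. For prime $\alpha=U\beta UD_k$, its lowering is $\alpha^\flat=\beta UD_{k-1}\in\mathcal{A}$. A peakless Motzkin path of length $n$ is a path from $(0,0)$ to $(n,0)$ weakly above the $x$-axis with steps $U$, $D=(1,-1)$, $F=(1,0)$ and no factor $UD$; $\mathcal{M}_n$ is their set, $\mathcal{M}=\bigcup_{n\ge1}\mathcal{M}_n$ (non-empty ones). The bijection $\psi:\mathcal{A}_n\to\mathcal{M}_{n-1}$ is defined recursively: $\psi(UD)=F$; $\psi(\beta UD)=U\psi(\beta)D$ for $\beta\in\mathcal{A}$; $\psi(\alpha)=\psi(\alpha^\flat)F$ for $\alpha\in\mathcal{P}$; $\psi(\beta\gamma)=\psi(\gamma^\flat)U\psi(\beta)D$ for $\beta\in\mathcal{A},\gamma\in\mathcal{P}$. For a word $w$ of steps, boldface $\mathbf{w}(\alpha)$ denotes the number of occurrences of $w$ as a factor (consecutive steps) in $\alpha$; in paths with air pockets, $D$ means $D_1$. $\mathbf{\Delta_k}(\alpha)$ is the number of occurrences of the factor $U^kD_k$ in $\alpha$; $\mathbf{Peak}(\alpha)=\sum_{j\ge1}\mathbf{UD_j}(\alpha)$;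 $\mathbf{Ret}$ of a path is the number of its steps ending on the $x$-axis; $\mathbf{SLast}(\alpha)=k$ if the last step of $\alpha$ is $D_k$; $\mathbf{LastF}(\mu)$ is the position (index, steps numbered from $1$) of the rightmost $F$-step of $\mu$. $\mathbb{1}_\beta(\mu)=1$ if $\mu=\beta$ and $0$ otherwise; $\mathbb{1}_{U\mathcal{M}D}(\mu)=1$ if $\mu=U\beta D$ for some $\beta\in\mathcal{M}$ and $0$ otherwise; $\mathbb{1}_{F^{k-1}U\mathcal{M}D}(\mu)=1$ if $\mu=F^{k-1}U\beta D$ for some $\beta\in\mathcal{M}$ and $0$ otherwise; $\mathbf{U^2\mathcal{M}D^2}(\mu)$ is the number of factors of $\mu$ of the form $UU\beta DD$ with $\beta\in\mathcal{M}$; $\mathbf{UF^{k-1}U\mathcal{M}D^2}(\mu)$ is the number of factors of $\mu$ of the form $UF^{k-1}U\beta DD$ with $\beta\in\mathcal{M}$. -}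

module Defs where

open import Data.Nat using (ℕ; zero; suc; _+_; _∸_; _≤_; _≡ᵇ_)
open import Data.Integer as ℤ using (ℤ; +_; -_)
open import Data.Bool using (Bool; true; false; _∧_; _∨_; not; if_then_else_)
open import Data.List using (List; []; _∷_; _++_; length; map; concatMap; inits; tails; filterᵇ; replicate)
open import Data.Bool.ListAction using (any)
open import Relation.Binary.PropositionalEquality using (_≡_; _≢_)
open import Data.Product using (_×_)

-- Steps of paths with air pockets: up = U = (1,1), dn k = D_k = (1,-k).
-- (Validity, below, requires k ≥ 1.)  D = D_1 = dn 1.
data AStep : Set where
  up : AStep
  dn : ℕ → AStep

data MStep : Set where
  U D F : MStep

eqA : AStep → AStep → Bool
eqA up     up     = true
eqA (dn k) (dn l) = k ≡ᵇ l
eqA _      _      = false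

eqM : MStep → MStep → Bool
eqM U U = true
eqM D D = true
eqM F F = true
eqM _ _ = false

eqList : {A : Set} → (A → A → Bool) → List A → List A → Bool
eqList e []       []       = true
eqList e (x ∷ xs) (y ∷ ys) = e x y ∧ eqList e xs ys
eqList e _        _        = false

heightA : List AStep → ℤ
heightA []          = + 0
heightA (up ∷ s)    = ℤ.suc (heightA s)
heightA (dn k ∷ s)  = (- (+ k)) ℤ.+ heightA s

heightM : List MStep → ℤ
heightM []       = + 0
heightM (U ∷ s)  = ℤ.suc (heightM s)
heightM (D ∷ s)  = ℤ.pred (heightM s)
heightM (F ∷ s)  = heightM s

-- APath h b α : α is a valid sequence of steps starting at height h,
-- staying weakly above the x-axis, ending on the x-axis, using D_k with
-- k ≥ 1 only, and with no two consecutive down-steps; b records whether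
-- the previous step was a down-step (a down-step is only allowed if b = false).
data APath : ℕ → Bool → List AStep → Set where
  done : ∀ {b} → APath 0 b []
  stepU : ∀ {h b α} → APath (suc h) false α → APath h b (up ∷ α)
  stepD : ∀ {h k α} → 1 ≤ k → APath h true α → APath (k + h) false (dn k ∷ α)

IsA : List AStep → Set
IsA α = APath 0 false α × α ≢ []

IsAn : ℕ → List AStep → Set
IsAn n α = IsA α × length α ≡ n

data EndsWithDk≥2 : List AStep → Set where
  endHere : ∀ {k} → 2 ≤ k → EndsWithDk≥2 (dn k ∷ [])
  endLater : ∀ {x y ys} → EndsWithDk≥2 (y ∷ ys) → EndsWithDk≥2 (x ∷ y ∷ ys)

IsP : List AStep → Set
IsP α = IsA α × EndsWithDk≥2 α
        × (∀ β γ → α ≡ β ++ γ → β ≢ [] → γ ≢ [] → heightA β ≢ + 0)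

decLast : List AStep → List AStep
decLast []              = []
decLast (up ∷ [])       = up ∷ []
decLast (dn k ∷ [])     = dn (k ∸ 1) ∷ []
decLast (x ∷ y ∷ ys)    = x ∷ decLast (y ∷ ys)

lower : List AStep → List AStep
lower (up ∷ s) = decLast s
lower s        = s    -- never used on prime paths

mOK : ℕ → List MStep → Bool
mOK zero    []       = true
mOK (suc h) []       = false
mOK h       (U ∷ s)  = mOK (suc h) s
mOK h       (F ∷ s)  = mOK h s
mOK zero    (D ∷ s)  = false
mOK (suc h) (D ∷ s)  = mOK h s

noPeak : List MStep → Bool
noPeak []            = true
noPeak (U ∷ D ∷ s)   = false
noPeak (x ∷ s)       = noPeak s

nonEmpty : {A : Set} → List A → Bool
nonEmpty []      = false
nonEmpty (_ ∷ _) = true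

isM : List MStep → Bool
isM μ = nonEmpty μ ∧ mOK 0 μ ∧ noPeak μ

-- The bijection ψ, as the graph of the paper's recursive definition.

data Ψ : List AStep → List MStep → Set where
  ψ-UD  : Ψ (up ∷ dn 1 ∷ []) (F ∷ [])
  ψ-βUD : ∀ {β μ} → IsA β → Ψ β μ
        → Ψ (β ++ up ∷ dn 1 ∷ []) (U ∷ μ ++ D ∷ [])
  ψ-P   : ∀ {α ν} → IsP α → Ψ (lower α) ν
        → Ψ α (ν ++ F ∷ [])
  ψ-βγ  : ∀ {β γ μ ν} → IsA β → IsP γ → Ψ β μ → Ψ (lower γ) ν
        → Ψ (β ++ γ) (ν ++ U ∷ μ ++ D ∷ [])

-- all factor occurrences (each contiguous factor at each position;
-- the empty factor also appears but is never counted below)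
factorList : {A : Set} → List A → List (List A)
factorList xs = concatMap inits (tails xs)

countF : {A : Set} → (List A → Bool) → List A → ℕ
countF p xs = length (filterᵇ p (factorList xs))

occA : List AStep → List AStep → ℕ
occA w = countF (eqList eqA w)

occM : List MStep → List MStep → ℕ
occM w = countF (eqList eqM w)

ind : List MStep → List MStep → ℕ
ind β μ = if eqList eqM β μ then 1 else 0

wrapped : List MStep → List MStep → List MStep → Bool
wrapped p s f = any (λ β → eqList eqM (p ++ β ++ s) f ∧ isM β) (factorList f)

indWrapped : List MStep → List MStep → List MStep → ℕ
indWrapped p s μ = if wrapped p s μ then 1 else 0

occWrapped : List MStep → List MStep → List MStep → ℕ
occWrapped p s = countF (wrapped p s)

Δ : ℕ → List AStep → ℕ
Δ k = occA (replicate k up ++ dn k ∷ [])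

isUDj : List AStep → Bool
isUDj (up ∷ dn (suc j) ∷ []) = true
isUDj _                      = false

Peak : List AStep → ℕ
Peak = countF isUDj

isZero : ℤ → Bool
isZero (+ 0) = true
isZero _     = false

RetA : List AStep → ℕ
RetA α = length (filterᵇ (λ p → nonEmpty p ∧ isZero (heightA p)) (inits α))

RetM : List MStep → ℕ
RetM μ = length (filterᵇ (λ p → nonEmpty p ∧ isZero (heightM p)) (inits μ))

SLast : List AStep → ℕ
SLast []            = 0
SLast (dn k ∷ [])   = k
SLast (up ∷ [])     = 0
SLast (x ∷ y ∷ ys)  = SLast (y ∷ ys)

-- 𝐋𝐚𝐬𝐭𝐅(μ): position (1-based) of the rightmost F (0 if there is none)
lastFgo : ℕ → ℕ → List MStep → ℕ
lastFgo i acc []       = acc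
lastFgo i acc (F ∷ s)  = lastFgo (suc i) i s
lastFgo i acc (U ∷ s)  = lastFgo (suc i) acc s
lastFgo i acc (D ∷ s)  = lastFgo (suc i) acc s

LastF : List MStep → ℕ
LastF = lastFgo 1 0

-- ψ is defined by recursion on the last block of α, so every statistic is
-- proved by induction along the derivation of Ψ α μ: each of the four
-- clauses of ψ preserves one invariant relating the statistics of α and μ,
-- strengthened by the occurrences of Uᵏ Dₖ at the very end of α.
-- On the Motzkin side the patterns to count (U Fᵏ D, U Fᵏ⁻¹ U ℳ D D) are
-- primitive words U g D with g a Motzkin path; since such a word has a
-- positive proper prefix height, an occurrence never straddles the boundary
-- between ν and F or between ν and U μ D, so these counts are additive over
-- the clauses of ψ.  On the air-pocket side the patterns Uᵏ Dₖ end with a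
-- down-step, so they never straddle the boundary after a down-step; for a
-- prime γ = U s Dₖ they can neither be a proper prefix nor a proper suffix
-- (γ does not return to the axis), which is how the counts of γ are read
-- off those of its lowering.
module Submission where

open import Defs
open import Data.Nat using (ℕ; zero; suc; _+_; _∸_; _≤_; _<_; z≤n; s≤s)
import Data.Nat.Properties as ℕ
open import Data.Nat.Induction using (<-wellFounded)
open import Induction.WellFounded using (Acc; acc)
open import Data.Integer as ℤ using (ℤ; +_; -_; -[1+_])
import Data.Integer.Properties as ℤ
open import Data.Integer.Tactic.RingSolver as ℤ-Solver using ()
open import Data.Bool using (Bool; true; false; _∧_; _∨_)
open import Data.Bool.Properties using (∧-identityʳ; ∧-zeroʳ; T-≡)
open import Function.Bundles using (Equivalence)
open import Data.Bool.ListAction using (any)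
open import Data.List using (List; []; _∷_; _++_; length; map; inits; filterᵇ; replicate)
open import Data.List.Membership.Propositional using (_∈_)
open import Data.List.Membership.Propositional.Properties using (∈-++⁺ˡ; ∈-++⁺ʳ)
open import Data.List.Relation.Unary.Any using (here; there)
open import Data.List.Properties using (++-assoc; ++-identityʳ; ∷-injective; ∷ʳ-injective; length-++; length-++-≤ʳ)
open import Data.Product using (Σ; _×_; _,_; proj₁; proj₂)
open import Data.Sum using (_⊎_; inj₁; inj₂)
open import Data.Empty using (⊥; ⊥-elim)
open import Relation.Binary.PropositionalEquality
open import Data.Nat.Tactic.RingSolver using (solve-∀)

toℕ : Bool → ℕ
toℕ true  = 1
toℕ false = 0

count : {A : Set} → (A → Bool) → List A → ℕ
count p xs = length (filterᵇ p xs)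

count-∷ : {A : Set} (p : A → Bool) → ∀ x xs → count p (x ∷ xs) ≡ toℕ (p x) + count p xs
count-∷ p x xs with p x
... | true  = refl
... | false = refl

count-++ : {A : Set} (p : A → Bool) → ∀ xs ys → count p (xs ++ ys) ≡ count p xs + count p ys
count-++ p []       ys = refl
count-++ p (x ∷ xs) ys = begin
  count p (x ∷ xs ++ ys)                 ≡⟨ count-∷ p x (xs ++ ys) ⟩
  toℕ (p x) + count p (xs ++ ys)         ≡⟨ cong (_+_ (toℕ (p x))) (count-++ p xs ys) ⟩
  toℕ (p x) + (count p xs + count p ys)  ≡⟨ ℕ.+-assoc (toℕ (p x)) _ _ ⟨
  (toℕ (p x) + count p xs) + count p ys  ≡⟨ cong (_+ count p ys) (count-∷ p x xs) ⟨
  count p (x ∷ xs) + count p ys          ∎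
  where open ≡-Reasoning

count-map : {A B : Set} (p : A → Bool) (f : B → A) → ∀ xs → count p (map f xs) ≡ count (λ y → p (f y)) xs
count-map p f []       = refl
count-map p f (x ∷ xs) = begin
  count p (f x ∷ map f xs)                  ≡⟨ count-∷ p (f x) (map f xs) ⟩
  toℕ (p (f x)) + count p (map f xs)        ≡⟨ cong (_+_ (toℕ (p (f x)))) (count-map p f xs) ⟩
  toℕ (p (f x)) + count (λ y → p (f y)) xs  ≡⟨ count-∷ (λ y → p (f y)) x xs ⟨
  count (λ y → p (f y)) (x ∷ xs)            ∎
  where open ≡-Reasoning

module _ {A : Set} where

  prefixCount : (List A → Bool) → List A → ℕ
  prefixCount p []       = 0
  prefixCount p (x ∷ xs) = toℕ (p (x ∷ [])) + prefixCount (λ t → p (x ∷ t)) xs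

  count-inits : ∀ p xs → count p (inits xs) ≡ toℕ (p []) + prefixCount p xs
  count-inits p []       = count-∷ p [] []
  count-inits p (x ∷ xs) = begin
    count p (inits (x ∷ xs))                    ≡⟨ count-∷ p [] _ ⟩
    toℕ (p []) + count p (map (x ∷_) (inits xs)) ≡⟨ cong (_+_ (toℕ (p []))) (count-map p (x ∷_) (inits xs)) ⟩
    toℕ (p []) + count (λ t → p (x ∷ t)) (inits xs)
      ≡⟨ cong (_+_ (toℕ (p []))) (count-inits (λ t → p (x ∷ t)) xs) ⟩
    toℕ (p []) + prefixCount p (x ∷ xs)         ∎
    where open ≡-Reasoning

  countF-∷ : ∀ p x xs → p [] ≡ false → countF p (x ∷ xs) ≡ prefixCount p (x ∷ xs) + countF p xs
  countF-∷ p x xs p[]≡false = begin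
    countF p (x ∷ xs)                                       ≡⟨ count-++ p (inits (x ∷ xs)) (factorList xs) ⟩
    count p (inits (x ∷ xs)) + countF p xs                  ≡⟨ cong (_+ countF p xs) (count-inits p (x ∷ xs)) ⟩
    toℕ (p []) + prefixCount p (x ∷ xs) + countF p xs       ≡⟨ cong (λ b → toℕ b + prefixCount p (x ∷ xs) + countF p xs) p[]≡false ⟩
    prefixCount p (x ∷ xs) + countF p xs                    ∎
    where open ≡-Reasoning

  countF-[] : ∀ (p : List A → Bool) → p [] ≡ false → countF p [] ≡ 0
  countF-[] p p[]≡false = trans (count-∷ p [] []) (cong (λ b → toℕ b + 0) p[]≡false)

  prefixCount-cong : ∀ p q xs → (∀ y t → p (y ∷ t) ≡ q (y ∷ t)) → prefixCount p xs ≡ prefixCount q xs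
  prefixCount-cong p q []       p≗q = refl
  prefixCount-cong p q (x ∷ xs) p≗q =
    cong₂ _+_ (cong toℕ (p≗q x [])) (prefixCount-cong _ _ xs (λ y t → p≗q x (y ∷ t)))

  prefixCount-++ : ∀ p xs ys →
    prefixCount p (xs ++ ys) ≡ prefixCount p xs + prefixCount (λ t → p (xs ++ t)) ys
  prefixCount-++ p []       ys = refl
  prefixCount-++ p (x ∷ xs) ys =
    trans (cong (_+_ (toℕ (p (x ∷ [])))) (prefixCount-++ (λ t → p (x ∷ t)) xs ys))
          (sym (ℕ.+-assoc (toℕ (p (x ∷ []))) _ _))

  prefixCount-false : ∀ xs → prefixCount (λ _ → false) xs ≡ 0
  prefixCount-false []       = refl
  prefixCount-false (x ∷ xs) = prefixCount-false xs

  prefixCount-≡0 : ∀ q ys → (∀ x t u → (x ∷ t) ++ u ≡ ys → q (x ∷ t) ≡ false) → prefixCount q ys ≡ 0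
  prefixCount-≡0 q []       h = refl
  prefixCount-≡0 q (y ∷ ys) h rewrite h y [] ys refl =
    prefixCount-≡0 (λ t → q (y ∷ t)) ys (λ x t u e → h y (x ∷ t) u (cong (y ∷_) e))

  prefixCount-whole : ∀ q y ys → (∀ x t u → (x ∷ t) ++ u ≡ y ∷ ys → u ≢ [] → q (x ∷ t) ≡ false) →
    prefixCount q (y ∷ ys) ≡ toℕ (q (y ∷ ys))
  prefixCount-whole q y []       h = ℕ.+-identityʳ _
  prefixCount-whole q y (z ∷ zs) h rewrite h y [] (z ∷ zs) refl (λ ()) =
    prefixCount-whole (λ t → q (y ∷ t)) z zs (λ x t u e u≢[] → h y (x ∷ t) u (cong (y ∷_) e) u≢[])

  -- the number of factors of xs ++ ys satisfying p that meet both xs and ys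
  crossCount : (List A → Bool) → List A → List A → ℕ
  crossCount p []       ys = 0
  crossCount p (x ∷ xs) ys = prefixCount (λ t → p ((x ∷ xs) ++ t)) ys + crossCount p xs ys

  countF-++ : ∀ p xs ys → p [] ≡ false →
    countF p (xs ++ ys) ≡ countF p xs + crossCount p xs ys + countF p ys
  countF-++ p []       ys p[]≡false = sym (cong (λ z → z + 0 + countF p ys) (countF-[] p p[]≡false))
  countF-++ p (x ∷ xs) ys p[]≡false = begin
    countF p (x ∷ xs ++ ys)                             ≡⟨ countF-∷ p x (xs ++ ys) p[]≡false ⟩
    prefixCount p (x ∷ xs ++ ys) + countF p (xs ++ ys)
      ≡⟨ cong₂ _+_ (prefixCount-++ p (x ∷ xs) ys) (countF-++ p xs ys p[]≡false) ⟩
    (a + b) + (c + d + e)                               ≡⟨ rearrange a b c d e ⟩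
    (a + c) + (b + d) + e                               ≡⟨ cong (λ z → z + (b + d) + e) (countF-∷ p x xs p[]≡false) ⟨
    countF p (x ∷ xs) + crossCount p (x ∷ xs) ys + countF p ys ∎
    where
      open ≡-Reasoning
      a b c d e : ℕ
      a = prefixCount p (x ∷ xs)
      b = prefixCount (λ t → p ((x ∷ xs) ++ t)) ys
      c = countF p xs
      d = crossCount p xs ys
      e = countF p ys
      rearrange : ∀ a b c d e → (a + b) + (c + d + e) ≡ (a + c) + (b + d) + e
      rearrange = solve-∀

  crossCount-≡0 : ∀ p xs ys →
    (∀ r a s b t u → r ++ (a ∷ s) ≡ xs → (b ∷ t) ++ u ≡ ys → p ((a ∷ s) ++ (b ∷ t)) ≡ false) →
    crossCount p xs ys ≡ 0
  crossCount-≡0 p []       ys h = refl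
  crossCount-≡0 p (x ∷ xs) ys h = cong₂ _+_
    (prefixCount-≡0 _ ys (λ b t u e → h [] x xs b t u refl e))
    (crossCount-≡0 p xs ys (λ r a s b t u e₁ e₂ → h (x ∷ r) a s b t u (cong (x ∷_) e₁) e₂))

  startsWith : (A → A → Bool) → List A → List A → Bool
  startsWith e []      ys       = true
  startsWith e (a ∷ w) []       = false
  startsWith e (a ∷ w) (y ∷ ys) = e a y ∧ startsWith e w ys

  matches : (A → A → Bool) → List A → List A → ℕ
  matches e w []       = 0
  matches e w (x ∷ xs) = toℕ (startsWith e w (x ∷ xs)) + matches e w xs

  suffixMatches : (A → A → Bool) → List A → List A → ℕ
  suffixMatches e w []       = 0
  suffixMatches e w (x ∷ xs) = toℕ (eqList e w (x ∷ xs)) + suffixMatches e w xs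

  prefixCount-eqList-[] : ∀ e xs → prefixCount (eqList e []) xs ≡ 0
  prefixCount-eqList-[] e []       = refl
  prefixCount-eqList-[] e (x ∷ xs) = prefixCount-false xs

  prefixCount-eqList : ∀ e a w xs → prefixCount (eqList e (a ∷ w)) xs ≡ toℕ (startsWith e (a ∷ w) xs)
  prefixCount-eqList e a w []       = refl
  prefixCount-eqList e a w (x ∷ xs) with e a x
  ... | false = prefixCount-false xs
  prefixCount-eqList e a []      (x ∷ xs) | true = cong suc (prefixCount-eqList-[] e xs)
  prefixCount-eqList e a (b ∷ w) (x ∷ xs) | true = prefixCount-eqList e b w xs

  countF-eqList : ∀ e a w xs → countF (eqList e (a ∷ w)) xs ≡ matches e (a ∷ w) xs
  countF-eqList e a w []       = refl
  countF-eqList e a w (x ∷ xs) = trans (countF-∷ (eqList e (a ∷ w)) x xs refl)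
    (cong₂ _+_ (prefixCount-eqList e a w (x ∷ xs)) (countF-eqList e a w xs))

  matches-singleton : ∀ e a xs → matches e (a ∷ []) xs ≡ count (e a) xs
  matches-singleton e a []       = refl
  matches-singleton e a (x ∷ xs) =
    trans (cong₂ _+_ (cong toℕ (∧-identityʳ (e a x))) (matches-singleton e a xs)) (sym (count-∷ (e a) x xs))

  startsWith-∷ʳ : ∀ e w ys x →
    toℕ (startsWith e w (ys ++ x ∷ [])) ≡ toℕ (startsWith e w ys) + toℕ (eqList e w (ys ++ x ∷ []))
  startsWith-∷ʳ e []          []       x = refl
  startsWith-∷ʳ e []          (y ∷ ys) x = refl
  startsWith-∷ʳ e (a ∷ [])    []       x with e a x
  ... | true  = refl
  ... | false = refl
  startsWith-∷ʳ e (a ∷ b ∷ w) []       x with e a x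
  ... | true  = refl
  ... | false = refl
  startsWith-∷ʳ e (a ∷ w)     (y ∷ ys) x with e a y
  ... | true  = startsWith-∷ʳ e w ys x
  ... | false = refl

  matches-∷ʳ : ∀ e a w xs x →
    matches e (a ∷ w) (xs ++ x ∷ []) ≡ matches e (a ∷ w) xs + suffixMatches e (a ∷ w) (xs ++ x ∷ [])
  matches-∷ʳ e a w [] x with e a x
  ... | false = refl
  matches-∷ʳ e a []      [] x | true = refl
  matches-∷ʳ e a (b ∷ w) [] x | true = refl
  matches-∷ʳ e a w (y ∷ xs) x = begin
    toℕ (startsWith e (a ∷ w) (y ∷ xs ++ x ∷ [])) + matches e (a ∷ w) (xs ++ x ∷ [])
      ≡⟨ cong₂ _+_ (startsWith-∷ʳ e (a ∷ w) (y ∷ xs) x) (matches-∷ʳ e a w xs x) ⟩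
    (P + Q) + (R + S) ≡⟨ interchange P Q R S ⟩
    (P + R) + (Q + S) ∎
    where
      open ≡-Reasoning
      interchange : ∀ a b c d → (a + b) + (c + d) ≡ (a + c) + (b + d)
      interchange = solve-∀
      P Q R S : ℕ
      P = toℕ (startsWith e (a ∷ w) (y ∷ xs))
      Q = toℕ (eqList e (a ∷ w) (y ∷ xs ++ x ∷ []))
      R = matches e (a ∷ w) xs
      S = suffixMatches e (a ∷ w) (xs ++ x ∷ [])

bool-≡ : (a b : Bool) → (a ≡ true → b ≡ true) → (b ≡ true → a ≡ true) → a ≡ b
bool-≡ true  b    a⇒b b⇒a = sym (a⇒b refl)
bool-≡ false true  a⇒b b⇒a = b⇒a refl
bool-≡ false false a⇒b b⇒a = refl

∧-true : (a b : Bool) → a ∧ b ≡ true → a ≡ true × b ≡ true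
∧-true true true refl = refl , refl

module _ {A : Set} (e : A → A → Bool) where

  eqList-sound : (∀ x y → e x y ≡ true → x ≡ y) → ∀ xs ys → eqList e xs ys ≡ true → xs ≡ ys
  eqList-sound e-sound []       []       h = refl
  eqList-sound e-sound (x ∷ xs) (y ∷ ys) h with ∧-true (e x y) _ h
  ... | x≈y , xs≈ys = cong₂ _∷_ (e-sound x y x≈y) (eqList-sound e-sound xs ys xs≈ys)

  eqList-refl : (∀ x → e x x ≡ true) → ∀ xs → eqList e xs xs ≡ true
  eqList-refl e-refl []       = refl
  eqList-refl e-refl (x ∷ xs) rewrite e-refl x = eqList-refl e-refl xs

  eqList-∷ʳ : ∀ xs ys a b → eqList e (xs ++ a ∷ []) (ys ++ b ∷ []) ≡ (eqList e xs ys ∧ e a b)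
  eqList-∷ʳ [] [] a b with e a b
  ... | true  = refl
  ... | false = refl
  eqList-∷ʳ [] (y ∷ ys) a b with e a y
  ... | false = refl
  eqList-∷ʳ [] (y ∷ [])     a b | true = refl
  eqList-∷ʳ [] (y ∷ z ∷ ys) a b | true = refl
  eqList-∷ʳ (x ∷ xs) [] a b with e x b
  ... | false = refl
  eqList-∷ʳ (x ∷ [])     [] a b | true = refl
  eqList-∷ʳ (x ∷ z ∷ xs) [] a b | true = refl
  eqList-∷ʳ (x ∷ xs) (y ∷ ys) a b with e x y
  ... | false = refl
  ... | true  = eqList-∷ʳ xs ys a b

eqM-sound : ∀ x y → eqM x y ≡ true → x ≡ y
eqM-sound U U _ = refl
eqM-sound D D _ = refl
eqM-sound F F _ = refl

eqM-refl : ∀ x → eqM x x ≡ true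
eqM-refl U = refl
eqM-refl D = refl
eqM-refl F = refl

eqListM-sound : ∀ xs ys → eqList eqM xs ys ≡ true → xs ≡ ys
eqListM-sound = eqList-sound eqM eqM-sound

eqListM-refl : ∀ xs → eqList eqM xs xs ≡ true
eqListM-refl = eqList-refl eqM eqM-refl

eqA-sound : ∀ x y → eqA x y ≡ true → x ≡ y
eqA-sound up     up     _   = refl
eqA-sound (dn k) (dn l) k≡l = cong dn (ℕ.≡ᵇ⇒≡ k l (Equivalence.from T-≡ k≡l))

eqA-refl : ∀ x → eqA x x ≡ true
eqA-refl up     = refl
eqA-refl (dn k) = Equivalence.to T-≡ (ℕ.≡⇒≡ᵇ k k refl)

eqListA-sound : ∀ xs ys → eqList eqA xs ys ≡ true → xs ≡ ys
eqListA-sound = eqList-sound eqA eqA-sound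

eqListA-refl : ∀ xs → eqList eqA xs xs ≡ true
eqListA-refl = eqList-refl eqA eqA-refl

++-≡-∷ʳ-prefix : {A : Set} (x u m : List A) (d : A) → x ++ u ≡ m ++ d ∷ [] → u ≢ [] →
  Σ (List A) λ u′ → m ≡ x ++ u′
++-≡-∷ʳ-prefix []      u m d e u≢[] = m , refl
++-≡-∷ʳ-prefix (y ∷ x) u [] d e u≢[] with ∷-injective e
++-≡-∷ʳ-prefix (y ∷ [])    []      [] d e u≢[] | _ , _  = ⊥-elim (u≢[] refl)
++-≡-∷ʳ-prefix (y ∷ [])    (z ∷ u) [] d e u≢[] | _ , ()
++-≡-∷ʳ-prefix (y ∷ w ∷ x) u       [] d e u≢[] | _ , ()
++-≡-∷ʳ-prefix (y ∷ x) u (z ∷ m) d e u≢[] with ∷-injective e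
... | refl , e′ with ++-≡-∷ʳ-prefix x u m d e′ u≢[]
... | u′ , refl = u′ , refl

replicate-suc-∷ʳ : {A : Set} (k : ℕ) (a : A) → replicate (suc k) a ≡ replicate k a ++ a ∷ []
replicate-suc-∷ʳ zero    a = refl
replicate-suc-∷ʳ (suc k) a = cong (a ∷_) (replicate-suc-∷ʳ k a)

i+j≡0⇒j≡-i : ∀ (i j : ℤ) → i ℤ.+ j ≡ + 0 → j ≡ - i
i+j≡0⇒j≡-i i j i+j≡0 = begin
  j                  ≡⟨ cancel i j ⟩
  - i ℤ.+ (i ℤ.+ j)  ≡⟨ cong (λ z → - i ℤ.+ z) i+j≡0 ⟩
  - i ℤ.+ + 0        ≡⟨ ℤ.+-identityʳ (- i) ⟩
  - i                ∎
  where
    open ≡-Reasoning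
    cancel : ∀ i j → j ≡ - i ℤ.+ (i ℤ.+ j)
    cancel = ℤ-Solver.solve-∀

suc-i+j≡i+suc-j : ∀ (i j : ℤ) → (+ 1 ℤ.+ i) ℤ.+ j ≡ i ℤ.+ (+ 1 ℤ.+ j)
suc-i+j≡i+suc-j = ℤ-Solver.solve-∀

i+j≡suc-i+pred-j : ∀ (i j : ℤ) → i ℤ.+ j ≡ (+ 1 ℤ.+ i) ℤ.+ (ℤ.-1ℤ ℤ.+ j)
i+j≡suc-i+pred-j = ℤ-Solver.solve-∀

heightM-++ : ∀ xs ys → heightM (xs ++ ys) ≡ heightM xs ℤ.+ heightM ys
heightM-++ []       ys = sym (ℤ.+-identityˡ _)
heightM-++ (U ∷ xs) ys = trans (cong ℤ.suc (heightM-++ xs ys)) (sym (ℤ.+-assoc (+ 1) (heightM xs) (heightM ys)))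
heightM-++ (D ∷ xs) ys = trans (cong ℤ.pred (heightM-++ xs ys)) (sym (ℤ.+-assoc ℤ.-1ℤ (heightM xs) (heightM ys)))
heightM-++ (F ∷ xs) ys = heightM-++ xs ys

mOK-++⇒ : ∀ h a b → mOK h (a ++ b) ≡ true → Σ ℕ λ h′ → (+ h ℤ.+ heightM a ≡ + h′) × mOK h′ b ≡ true
mOK-++⇒ h       []      b ok = h , ℤ.+-identityʳ (+ h) , ok
mOK-++⇒ zero    (U ∷ a) b ok with mOK-++⇒ 1 a b ok
... | h′ , eq , ok′ = h′ , trans (sym (suc-i+j≡i+suc-j (+ 0) (heightM a))) eq , ok′
mOK-++⇒ (suc h) (U ∷ a) b ok with mOK-++⇒ (suc (suc h)) a b ok
... | h′ , eq , ok′ = h′ , trans (sym (suc-i+j≡i+suc-j (+ suc h) (heightM a))) eq , ok′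
mOK-++⇒ zero    (F ∷ a) b ok = mOK-++⇒ zero a b ok
mOK-++⇒ (suc h) (F ∷ a) b ok = mOK-++⇒ (suc h) a b ok
mOK-++⇒ (suc h) (D ∷ a) b ok with mOK-++⇒ h a b ok
... | h′ , eq , ok′ = h′ , trans (sym (i+j≡suc-i+pred-j (+ h) (heightM a))) eq , ok′

mOK⇒height : ∀ h b → mOK h b ≡ true → + h ℤ.+ heightM b ≡ + 0
mOK⇒height h b ok with mOK-++⇒ h b [] (subst (λ z → mOK h z ≡ true) (sym (++-identityʳ b)) ok)
... | zero , eq , _ = eq

motzkin-height : ∀ m → mOK 0 m ≡ true → heightM m ≡ + 0
motzkin-height m ok = trans (sym (ℤ.+-identityˡ _)) (mOK⇒height 0 m ok)

motzkin-prefix-height : ∀ a b → mOK 0 (a ++ b) ≡ true → Σ ℕ λ n → heightM a ≡ + n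
motzkin-prefix-height a b ok with mOK-++⇒ 0 a b ok
... | h′ , eq , _ = h′ , trans (sym (ℤ.+-identityˡ _)) eq

motzkin-suffix-height : ∀ a b → mOK 0 (a ++ b) ≡ true → Σ ℕ λ n → heightM b ≡ - (+ n)
motzkin-suffix-height a b ok with motzkin-prefix-height a b ok
... | n , ha = n , trans (i+j≡0⇒j≡-i (heightM a) (heightM b)
                          (trans (sym (heightM-++ a b)) (motzkin-height (a ++ b) ok))) (cong -_ ha)

neg≢1 : ∀ n → - (+ n) ≢ + 1
neg≢1 zero    ()
neg≢1 (suc n) ()

Primitive : List MStep → Set
Primitive f = Σ (List MStep) λ g → (f ≡ U ∷ g ++ D ∷ []) × mOK 0 g ≡ true

primitive-height : ∀ f → Primitive f → heightM f ≡ + 0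
primitive-height f (g , refl , ok) = begin
  ℤ.suc (heightM (g ++ D ∷ []))  ≡⟨ cong ℤ.suc (heightM-++ g (D ∷ [])) ⟩
  ℤ.suc (heightM g ℤ.+ ℤ.-1ℤ)    ≡⟨ cong (λ z → ℤ.suc (z ℤ.+ ℤ.-1ℤ)) (motzkin-height g ok) ⟩
  + 0                            ∎
  where open ≡-Reasoning

primitive-prefix-height : ∀ f a b → Primitive f → f ≡ a ++ b → a ≢ [] → b ≢ [] →
  Σ ℕ λ n → heightM a ≡ + suc n
primitive-prefix-height f []      b _ _ a≢[] _ = ⊥-elim (a≢[] refl)
primitive-prefix-height f (x ∷ a) b (g , refl , ok) e _ b≢[] with ∷-injective e
... | refl , e′ with ++-≡-∷ʳ-prefix a b g D (sym e′) b≢[]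
... | u , refl with motzkin-prefix-height a u ok
... | n , ha = n , cong ℤ.suc ha

primitive-suffix-height : ∀ f a b → Primitive f → f ≡ a ++ b → a ≢ [] → b ≢ [] →
  Σ ℕ λ n → heightM b ≡ -[1+ n ]
primitive-suffix-height f a b pf e a≢[] b≢[] with primitive-prefix-height f a b pf e a≢[] b≢[]
... | n , ha = n , trans (i+j≡0⇒j≡-i (heightM a) (heightM b)
                          (trans (sym (heightM-++ a b)) (trans (cong heightM (sym e)) (primitive-height f pf))))
                        (cong -_ ha)

OnlyPrimitive : (List MStep → Bool) → Set
OnlyPrimitive P = ∀ f → P f ≡ true → Primitive f

onlyPrimitive-[] : ∀ P → OnlyPrimitive P → P [] ≡ false
onlyPrimitive-[] P only with P [] in eq
... | false = refl
... | true with only [] eq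
... | _ , () , _

onlyPrimitive-[_] : ∀ {P} x → OnlyPrimitive P → P (x ∷ []) ≡ false
onlyPrimitive-[_] {P} x only with P (x ∷ []) in eq
... | false = refl
... | true with only _ eq
... | []    , () , _
... | _ ∷ _ , () , _

countF-onlyPrimitive-[_] : ∀ {P} x → OnlyPrimitive P → countF P (x ∷ []) ≡ 0
countF-onlyPrimitive-[_] {P} x only = begin
  countF P (x ∷ [])                        ≡⟨ countF-∷ P x [] P[]≡false ⟩
  toℕ (P (x ∷ [])) + 0 + countF P []       ≡⟨ cong (λ b → toℕ b + 0 + countF P []) (onlyPrimitive-[ x ] only) ⟩
  countF P []                              ≡⟨ countF-[] P P[]≡false ⟩
  0                                        ∎
  where
    open ≡-Reasoning
    P[]≡false : P [] ≡ false
    P[]≡false = onlyPrimitive-[] P only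

module _ (P : List MStep → Bool) (only : OnlyPrimitive P) where

  private
    P[]≡false : P [] ≡ false
    P[]≡false = onlyPrimitive-[] P only

  countF-wrap : ∀ m → mOK 0 m ≡ true →
    countF P (U ∷ m ++ D ∷ []) ≡ countF P m + toℕ (P (U ∷ m ++ D ∷ []))
  countF-wrap m ok = begin
    countF P ((U ∷ m) ++ D ∷ [])
      ≡⟨ countF-++ P (U ∷ m) (D ∷ []) P[]≡false ⟩
    countF P (U ∷ m) + crossCount P (U ∷ m) (D ∷ []) + countF P (D ∷ [])
      ≡⟨ cong₂ _+_ (cong₂ _+_ countF-Um cross-UmD) (countF-onlyPrimitive-[ D ] only) ⟩
    countF P m + toℕ (P (U ∷ m ++ D ∷ [])) + 0
      ≡⟨ ℕ.+-identityʳ _ ⟩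
    countF P m + toℕ (P (U ∷ m ++ D ∷ [])) ∎
    where
      open ≡-Reasoning
      -- U m has no primitive prefix: U t with t a prefix of m has positive height
      no-prefix : ∀ x t u → (x ∷ t) ++ u ≡ U ∷ m → P (x ∷ t) ≡ false
      no-prefix x t u e with P (x ∷ t) in eq
      ... | false = refl
      ... | true with ∷-injective e
      ... | refl , e′ with motzkin-prefix-height t u (subst (λ z → mOK 0 z ≡ true) (sym e′) ok)
      ... | n , ht with trans (sym (cong ℤ.suc ht)) (primitive-height _ (only _ eq))
      ... | ()
      countF-Um : countF P (U ∷ m) ≡ countF P m
      countF-Um = trans (countF-∷ P U m P[]≡false) (cong (_+ countF P m) (prefixCount-≡0 P (U ∷ m) no-prefix))
      -- such a factor would be (a ∷ s) ++ D with a ∷ s = U g a suffix of m, of height 1 > 0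
      no-crossing : ∀ r a s b t u → r ++ (a ∷ s) ≡ m → (b ∷ t) ++ u ≡ D ∷ [] → P ((a ∷ s) ++ (b ∷ t)) ≡ false
      no-crossing r a s b t u e₁ e₂ with P ((a ∷ s) ++ (b ∷ t)) in eq
      ... | false = refl
      ... | true with ∷-injective e₂
      no-crossing r a s b [] [] e₁ e₂ | true | refl , _ with only _ eq
      ... | g , e₃ , ok₃ with ∷ʳ-injective (a ∷ s) (U ∷ g) e₃
      ... | as≡Ug , _ with motzkin-suffix-height r (a ∷ s) (subst (λ z → mOK 0 z ≡ true) (sym e₁) ok)
      ... | n , hs = ⊥-elim (neg≢1 n (trans (sym hs) (trans (cong heightM as≡Ug) (cong ℤ.suc (motzkin-height g ok₃)))))
      cross-UmD : crossCount P (U ∷ m) (D ∷ []) ≡ toℕ (P (U ∷ m ++ D ∷ []))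
      cross-UmD = trans (cong (_+_ (toℕ (P (U ∷ m ++ D ∷ [])) + 0)) (crossCount-≡0 P m (D ∷ []) no-crossing))
                        (trans (ℕ.+-identityʳ _) (ℕ.+-identityʳ _))

  countF-∷ʳF : ∀ ν → countF P (ν ++ F ∷ []) ≡ countF P ν
  countF-∷ʳF ν = begin
    countF P (ν ++ F ∷ [])                                   ≡⟨ countF-++ P ν (F ∷ []) P[]≡false ⟩
    countF P ν + crossCount P ν (F ∷ []) + countF P (F ∷ [])
      ≡⟨ cong₂ (λ a b → countF P ν + a + b) cross-F (countF-onlyPrimitive-[ F ] only) ⟩
    countF P ν + 0 + 0                                       ≡⟨ trans (ℕ.+-identityʳ _) (ℕ.+-identityʳ _) ⟩
    countF P ν                                               ∎
    where
      open ≡-Reasoning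
      no-crossing : ∀ r a s b t u → r ++ (a ∷ s) ≡ ν → (b ∷ t) ++ u ≡ F ∷ [] → P ((a ∷ s) ++ (b ∷ t)) ≡ false
      no-crossing r a s b t u e₁ e₂ with P ((a ∷ s) ++ (b ∷ t)) in eq
      ... | false = refl
      ... | true with ∷-injective e₂
      no-crossing r a s b [] [] e₁ e₂ | true | refl , _ with only _ eq
      ... | g , e₃ , _ with ∷ʳ-injective (a ∷ s) (U ∷ g) e₃
      ... | _ , ()
      cross-F : crossCount P ν (F ∷ []) ≡ 0
      cross-F = crossCount-≡0 P ν (F ∷ []) no-crossing

  countF-++wrap : ∀ ν m → mOK 0 m ≡ true →
    countF P (ν ++ U ∷ m ++ D ∷ []) ≡ countF P ν + countF P (U ∷ m ++ D ∷ [])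
  countF-++wrap ν m ok = begin
    countF P (ν ++ R)                          ≡⟨ countF-++ P ν R P[]≡false ⟩
    countF P ν + crossCount P ν R + countF P R ≡⟨ cong (λ a → countF P ν + a + countF P R) cross-R ⟩
    countF P ν + 0 + countF P R                ≡⟨ cong (_+ countF P R) (ℕ.+-identityʳ _) ⟩
    countF P ν + countF P R                    ∎
    where
      open ≡-Reasoning
      R : List MStep
      R = U ∷ m ++ D ∷ []
      R-primitive : Primitive R
      R-primitive = m , refl , ok
      -- a crossing primitive factor would end in a proper prefix of R (positive height)
      -- or in R itself (height 0), but it ends at negative height
      no-crossing : ∀ r a s b t u → r ++ (a ∷ s) ≡ ν → (b ∷ t) ++ u ≡ R → P ((a ∷ s) ++ (b ∷ t)) ≡ false
      no-crossing r a s b t u e₁ e₂ with P ((a ∷ s) ++ (b ∷ t)) in eq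
      ... | false = refl
      ... | true with primitive-suffix-height _ (a ∷ s) (b ∷ t) (only _ eq) refl (λ ()) (λ ())
      no-crossing r a s b t [] e₁ e₂ | true | n , hbt
        with trans (sym hbt) (trans (cong heightM (trans (sym (++-identityʳ _)) e₂)) (primitive-height R R-primitive))
      ... | ()
      no-crossing r a s b t (v ∷ u) e₁ e₂ | true | n , hbt
        with primitive-prefix-height R (b ∷ t) (v ∷ u) R-primitive (sym e₂) (λ ()) (λ ())
      ... | n′ , hbt′ with trans (sym hbt) hbt′
      ... | ()
      cross-R : crossCount P ν R ≡ 0
      cross-R = crossCount-≡0 P ν R no-crossing

mOK-U : ∀ h s → mOK h (U ∷ s) ≡ mOK (suc h) s
mOK-U zero    s = refl
mOK-U (suc h) s = refl

mOK-F : ∀ h s → mOK h (F ∷ s) ≡ mOK h s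
mOK-F zero    s = refl
mOK-F (suc h) s = refl

mOK-Fᵏ++ : ∀ j h ys → mOK h (replicate j F ++ ys) ≡ mOK h ys
mOK-Fᵏ++ zero    h ys = refl
mOK-Fᵏ++ (suc j) h ys = trans (mOK-F h _) (mOK-Fᵏ++ j h ys)

mOK-++ : ∀ a β h ys → mOK a β ≡ true → mOK (a + h) (β ++ ys) ≡ mOK h ys
mOK-++ zero    []      h ys ok = refl
mOK-++ (suc a) []      h ys ()
mOK-++ a       (U ∷ β) h ys ok rewrite mOK-U (a + h) (β ++ ys) | mOK-U a β = mOK-++ (suc a) β h ys ok
mOK-++ a       (F ∷ β) h ys ok rewrite mOK-F (a + h) (β ++ ys) | mOK-F a β = mOK-++ a β h ys ok
mOK-++ zero    (D ∷ β) h ys ()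
mOK-++ (suc a) (D ∷ β) h ys ok = mOK-++ a β h ys ok

mOK-wrap : ∀ m → mOK 0 m ≡ true → mOK 0 (U ∷ m ++ D ∷ []) ≡ true
mOK-wrap m ok = mOK-++ 0 m 1 (D ∷ []) ok

mOK-∷ʳU : ∀ h xs → mOK h (xs ++ U ∷ []) ≡ false
mOK-∷ʳU zero    []       = refl
mOK-∷ʳU (suc h) []       = refl
mOK-∷ʳU zero    (U ∷ xs) = mOK-∷ʳU 1 xs
mOK-∷ʳU (suc h) (U ∷ xs) = mOK-∷ʳU (suc (suc h)) xs
mOK-∷ʳU zero    (F ∷ xs) = mOK-∷ʳU zero xs
mOK-∷ʳU (suc h) (F ∷ xs) = mOK-∷ʳU (suc h) xs
mOK-∷ʳU zero    (D ∷ xs) = refl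
mOK-∷ʳU (suc h) (D ∷ xs) = mOK-∷ʳU h xs

isM-parts : ∀ β → isM β ≡ true → (nonEmpty β ≡ true) × (mOK 0 β ≡ true) × (noPeak β ≡ true)
isM-parts β β∈ℳ with ∧-true (nonEmpty β) _ β∈ℳ
... | ne , ok∧np with ∧-true (mOK 0 β) _ ok∧np
... | ok , np = ne , ok , np

isM-intro : ∀ β → nonEmpty β ≡ true → mOK 0 β ≡ true → noPeak β ≡ true → isM β ≡ true
isM-intro β ne ok np rewrite ne | ok | np = refl

isM⇒mOK : ∀ β → isM β ≡ true → mOK 0 β ≡ true
isM⇒mOK β β∈ℳ = proj₁ (proj₂ (isM-parts β β∈ℳ))

isM⇒≢[] : ∀ β → isM β ≡ true → β ≢ []
isM⇒≢[] [] ()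

isU : MStep → Bool
isU U = true
isU _ = false

endsWithU : List MStep → Bool
endsWithU []           = false
endsWithU (x ∷ [])     = isU x
endsWithU (x ∷ y ∷ ys) = endsWithU (y ∷ ys)

startsWithD : List MStep → Bool
startsWithD (D ∷ _) = true
startsWithD _       = false

noPeak-++ : ∀ xs ys → noPeak xs ≡ true → noPeak ys ≡ true → (endsWithU xs ∧ startsWithD ys) ≡ false →
  noPeak (xs ++ ys) ≡ true
noPeak-++ []           ys npx npy j = npy
noPeak-++ (U ∷ [])     []       npx npy j = refl
noPeak-++ (U ∷ [])     (U ∷ ys) npx npy j = npy
noPeak-++ (U ∷ [])     (F ∷ ys) npx npy j = npy
noPeak-++ (U ∷ [])     (D ∷ ys) npx npy ()
noPeak-++ (U ∷ U ∷ xs) ys npx npy j = noPeak-++ (U ∷ xs) ys npx npy j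
noPeak-++ (U ∷ F ∷ xs) ys npx npy j = noPeak-++ (F ∷ xs) ys npx npy j
noPeak-++ (U ∷ D ∷ xs) ys ()  npy j
noPeak-++ (D ∷ [])     ys npx npy j = npy
noPeak-++ (D ∷ y ∷ xs) ys npx npy j = noPeak-++ (y ∷ xs) ys npx npy j
noPeak-++ (F ∷ [])     ys npx npy j = npy
noPeak-++ (F ∷ y ∷ xs) ys npx npy j = noPeak-++ (y ∷ xs) ys npx npy j

endsWithU-sound : ∀ xs → endsWithU xs ≡ true → Σ (List MStep) λ xs′ → xs ≡ xs′ ++ U ∷ []
endsWithU-sound (U ∷ [])     _ = [] , refl
endsWithU-sound (x ∷ y ∷ ys) e with endsWithU-sound (y ∷ ys) e
... | xs′ , eq = x ∷ xs′ , cong (x ∷_) eq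

motzkin-endsWithU : ∀ h m → mOK h m ≡ true → endsWithU m ≡ false
motzkin-endsWithU h m ok with endsWithU m in eq
... | false = refl
... | true with endsWithU-sound m eq
... | xs′ , refl with trans (sym ok) (mOK-∷ʳU h xs′)
... | ()

motzkin-startsWithD : ∀ m → mOK 0 m ≡ true → startsWithD m ≡ false
motzkin-startsWithD []      ok = refl
motzkin-startsWithD (U ∷ m) ok = refl
motzkin-startsWithD (F ∷ m) ok = refl

endsWithU-∷ : ∀ x m → m ≢ [] → endsWithU (x ∷ m) ≡ endsWithU m
endsWithU-∷ x []      m≢[] = ⊥-elim (m≢[] refl)
endsWithU-∷ x (y ∷ m) m≢[] = refl

nonEmpty-++-∷ : {A : Set} (xs : List A) (y : A) (ys : List A) → nonEmpty (xs ++ y ∷ ys) ≡ true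
nonEmpty-++-∷ []      y ys = refl
nonEmpty-++-∷ (_ ∷ _) y ys = refl

isM-wrap : ∀ m → isM m ≡ true → isM (U ∷ m ++ D ∷ []) ≡ true
isM-wrap m m∈ℳ with isM-parts m m∈ℳ
... | _ , ok , np = isM-intro (U ∷ m ++ D ∷ []) refl (mOK-wrap m ok) np-UmD
  where
    np-Um : noPeak (U ∷ m) ≡ true
    np-Um = noPeak-++ (U ∷ []) m refl np (motzkin-startsWithD m ok)
    np-UmD : noPeak ((U ∷ m) ++ D ∷ []) ≡ true
    np-UmD = noPeak-++ (U ∷ m) (D ∷ []) np-Um refl
      (trans (cong (_∧ true) (trans (endsWithU-∷ U m (isM⇒≢[] m m∈ℳ)) (motzkin-endsWithU 0 m ok))) refl)

isM-∷ʳF : ∀ ν → isM ν ≡ true → isM (ν ++ F ∷ []) ≡ true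
isM-∷ʳF ν ν∈ℳ with isM-parts ν ν∈ℳ
... | _ , ok , np = isM-intro _ (nonEmpty-++-∷ ν F []) (mOK-++ 0 ν 0 (F ∷ []) ok)
                      (noPeak-++ ν (F ∷ []) np refl (∧-zeroʳ (endsWithU ν)))

isM-++wrap : ∀ ν m → isM ν ≡ true → isM m ≡ true → isM (ν ++ U ∷ m ++ D ∷ []) ≡ true
isM-++wrap ν m ν∈ℳ m∈ℳ with isM-parts ν ν∈ℳ | isM-parts (U ∷ m ++ D ∷ []) (isM-wrap m m∈ℳ)
... | _ , ok , np | _ , okR , npR =
  isM-intro (ν ++ U ∷ m ++ D ∷ []) (nonEmpty-++-∷ ν U _) (trans (mOK-++ 0 ν 0 (U ∷ m ++ D ∷ []) ok) okR)
    (noPeak-++ ν _ np npR (∧-zeroʳ (endsWithU ν)))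

any-sound : {A : Set} (q : A → Bool) → ∀ xs → any q xs ≡ true → Σ A λ x → q x ≡ true
any-sound q []       ()
any-sound q (x ∷ xs) e with q x in eq
... | true  = x , eq
... | false = any-sound q xs e

any-++ˡ : {A : Set} (q : A → Bool) → ∀ xs ys → any q xs ≡ true → any q (xs ++ ys) ≡ true
any-++ˡ q (x ∷ xs) ys e with q x
... | true  = refl
... | false = any-++ˡ q xs ys e

any-++ʳ : {A : Set} (q : A → Bool) → ∀ xs ys → any q ys ≡ true → any q (xs ++ ys) ≡ true
any-++ʳ q []       ys e = e
any-++ʳ q (x ∷ xs) ys e with q x
... | true  = refl
... | false = any-++ʳ q xs ys e

any-map : {A B : Set} (q : A → Bool) (f : B → A) → ∀ xs → any q (map f xs) ≡ any (λ y → q (f y)) xs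
any-map q f []       = refl
any-map q f (x ∷ xs) = cong (q (f x) ∨_) (any-map q f xs)

any-inits : {A : Set} (q : List A → Bool) → ∀ β s → q β ≡ true → any q (inits (β ++ s)) ≡ true
any-inits q []      s e with q [] | e
... | true | _ = refl
any-inits q (b ∷ β) s e with q []
... | true  = refl
... | false = trans (any-map q (b ∷_) (inits (β ++ s))) (any-inits (λ t → q (b ∷ t)) β s e)

any-factorList : {A : Set} (q : List A → Bool) → ∀ p β s → q β ≡ true → any q (factorList (p ++ β ++ s)) ≡ true
any-factorList q []      β s e = any-++ˡ q (inits (β ++ s)) _ (any-inits q β s e)
any-factorList q (x ∷ p) β s e = any-++ʳ q (inits (x ∷ p ++ β ++ s)) _ (any-factorList q p β s e)

wrapped-sound : ∀ p s f → wrapped p s f ≡ true → Σ (List MStep) λ β → (f ≡ p ++ β ++ s) × isM β ≡ true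
wrapped-sound p s f e with any-sound _ (factorList f) e
... | β , e′ with ∧-true _ _ e′
... | f≈pβs , β∈ℳ = β , sym (eqListM-sound _ _ f≈pβs) , β∈ℳ

wrapped-complete : ∀ p s β → isM β ≡ true → wrapped p s (p ++ β ++ s) ≡ true
wrapped-complete p s β β∈ℳ = any-factorList (λ b → eqList eqM (p ++ b ++ s) (p ++ β ++ s) ∧ isM b) p β s
  (trans (cong (_∧ isM β) (eqListM-refl (p ++ β ++ s))) β∈ℳ)

ind≡toℕ : ∀ β μ → ind β μ ≡ toℕ (eqList eqM β μ)
ind≡toℕ β μ with eqList eqM β μ
... | true  = refl
... | false = refl

indWrapped≡toℕ : ∀ p s μ → indWrapped p s μ ≡ toℕ (wrapped p s μ)
indWrapped≡toℕ p s μ with wrapped p s μ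
... | true  = refl
... | false = refl

isFᵏ : ℕ → List MStep → Bool
isFᵏ k = eqList eqM (replicate k F)

isUFᵏD : ℕ → List MStep → Bool
isUFᵏD k = eqList eqM (U ∷ replicate k F ++ D ∷ [])

isFᵏUℳD : ℕ → List MStep → Bool
isFᵏUℳD k = wrapped (replicate k F ++ U ∷ []) (D ∷ [])

isUFᵏUℳDD : ℕ → List MStep → Bool
isUFᵏUℳDD k = wrapped (U ∷ replicate k F ++ U ∷ []) (D ∷ D ∷ [])

isUFᵏD-primitive : ∀ k → OnlyPrimitive (isUFᵏD k)
isUFᵏD-primitive k f e with eqListM-sound (U ∷ replicate k F ++ D ∷ []) f e
... | refl = replicate k F , refl , trans (cong (mOK 0) (sym (++-identityʳ (replicate k F)))) (mOK-Fᵏ++ k 0 [])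

isUFᵏUℳDD-primitive : ∀ k → OnlyPrimitive (isUFᵏUℳDD k)
isUFᵏUℳDD-primitive k f e with wrapped-sound (U ∷ replicate k F ++ U ∷ []) (D ∷ D ∷ []) f e
... | β , refl , β∈ℳ = replicate k F ++ U ∷ β ++ D ∷ [] , reassociate , ok
  where
    reassociate : (U ∷ replicate k F ++ U ∷ []) ++ β ++ D ∷ D ∷ [] ≡ U ∷ (replicate k F ++ U ∷ β ++ D ∷ []) ++ D ∷ []
    reassociate = cong (U ∷_) (begin
      (replicate k F ++ U ∷ []) ++ β ++ D ∷ D ∷ []    ≡⟨ ++-assoc (replicate k F) (U ∷ []) _ ⟩
      replicate k F ++ U ∷ β ++ D ∷ D ∷ []            ≡⟨ cong (λ z → replicate k F ++ U ∷ z) (++-assoc β (D ∷ []) (D ∷ [])) ⟨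
      replicate k F ++ U ∷ (β ++ D ∷ []) ++ D ∷ []    ≡⟨ ++-assoc (replicate k F) (U ∷ β ++ D ∷ []) (D ∷ []) ⟨
      (replicate k F ++ U ∷ β ++ D ∷ []) ++ D ∷ []    ∎)
      where open ≡-Reasoning
    ok : mOK 0 (replicate k F ++ U ∷ β ++ D ∷ []) ≡ true
    ok = trans (mOK-Fᵏ++ k 0 _) (mOK-++ 0 β 1 (D ∷ []) (isM⇒mOK β β∈ℳ))

Fᵏ≢-++U : ∀ k xs ys → replicate k F ≢ xs ++ U ∷ ys
Fᵏ≢-++U zero    []       ys ()
Fᵏ≢-++U zero    (x ∷ xs) ys ()
Fᵏ≢-++U (suc k) []       ys ()
Fᵏ≢-++U (suc k) (x ∷ xs) ys e = Fᵏ≢-++U k xs ys (proj₂ (∷-injective e))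

isFᵏ-wrap : ∀ k m → isFᵏ k (U ∷ m ++ D ∷ []) ≡ false
isFᵏ-wrap zero    m = refl
isFᵏ-wrap (suc k) m = refl

isFᵏ⁺¹-∷ʳF : ∀ k ν → isFᵏ (suc k) (ν ++ F ∷ []) ≡ isFᵏ k ν
isFᵏ⁺¹-∷ʳF k ν = begin
  eqList eqM (replicate (suc k) F) (ν ++ F ∷ [])     ≡⟨ cong (λ z → eqList eqM z (ν ++ F ∷ [])) (replicate-suc-∷ʳ k F) ⟩
  eqList eqM (replicate k F ++ F ∷ []) (ν ++ F ∷ [])  ≡⟨ eqList-∷ʳ eqM (replicate k F) ν F F ⟩
  isFᵏ k ν ∧ true                                    ≡⟨ ∧-identityʳ _ ⟩
  isFᵏ k ν                                           ∎
  where open ≡-Reasoning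

isFᵏ-++wrap : ∀ k ν m → isFᵏ k (ν ++ U ∷ m ++ D ∷ []) ≡ false
isFᵏ-++wrap k ν m with isFᵏ k (ν ++ U ∷ m ++ D ∷ []) in eq
... | false = refl
... | true  = ⊥-elim (Fᵏ≢-++U k ν _ (eqListM-sound _ _ eq))

isF⁰-nonEmpty : ∀ ν → ν ≢ [] → isFᵏ 0 ν ≡ false
isF⁰-nonEmpty []      ν≢[] = ⊥-elim (ν≢[] refl)
isF⁰-nonEmpty (x ∷ ν) ν≢[] = refl

isUFᵏD-wrap : ∀ k m → isUFᵏD k (U ∷ m ++ D ∷ []) ≡ isFᵏ k m
isUFᵏD-wrap k m = trans (eqList-∷ʳ eqM (replicate k F) m D D) (∧-identityʳ _)

isF⁰UℳD-wrap : ∀ m → isM m ≡ true → isFᵏUℳD 0 (U ∷ m ++ D ∷ []) ≡ true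
isF⁰UℳD-wrap m m∈ℳ = wrapped-complete (U ∷ []) (D ∷ []) m m∈ℳ

isFᵏ⁺¹UℳD-wrap : ∀ k m → isFᵏUℳD (suc k) (U ∷ m ++ D ∷ []) ≡ false
isFᵏ⁺¹UℳD-wrap k m with isFᵏUℳD (suc k) (U ∷ m ++ D ∷ []) in eq
... | false = refl
... | true with wrapped-sound (replicate (suc k) F ++ U ∷ []) (D ∷ []) (U ∷ m ++ D ∷ []) eq
... | β , () , _

isFᵏUℳD-∷ʳF : ∀ k ν → isFᵏUℳD k (ν ++ F ∷ []) ≡ false
isFᵏUℳD-∷ʳF k ν with isFᵏUℳD k (ν ++ F ∷ []) in eq
... | false = refl
... | true with wrapped-sound (replicate k F ++ U ∷ []) (D ∷ []) (ν ++ F ∷ []) eq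
... | β , e , _ with ∷ʳ-injective ν ((replicate k F ++ U ∷ []) ++ β) (trans e (sym (++-assoc (replicate k F ++ U ∷ []) β (D ∷ []))))
... | _ , ()

Fᵏ-prefix-before-U : ∀ k xs ys β → mOK 0 xs ≡ true → mOK 0 β ≡ true →
  xs ++ U ∷ ys ≡ replicate k F ++ U ∷ β ++ D ∷ [] → xs ≡ replicate k F
Fᵏ-prefix-before-U zero    []       ys β okx okβ e = refl
Fᵏ-prefix-before-U zero    (U ∷ xs) ys β okx okβ e with ++-≡-∷ʳ-prefix xs (U ∷ ys) β D (proj₂ (∷-injective e)) (λ ())
... | u , refl with motzkin-prefix-height xs u okβ
... | n , hxs with trans (sym (cong ℤ.suc hxs)) (motzkin-height (U ∷ xs) okx)
... | ()
Fᵏ-prefix-before-U zero    (D ∷ xs) ys β okx okβ ()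
Fᵏ-prefix-before-U zero    (F ∷ xs) ys β okx okβ ()
Fᵏ-prefix-before-U (suc k) []       ys β okx okβ ()
Fᵏ-prefix-before-U (suc k) (U ∷ xs) ys β okx okβ ()
Fᵏ-prefix-before-U (suc k) (D ∷ xs) ys β okx okβ ()
Fᵏ-prefix-before-U (suc k) (F ∷ xs) ys β okx okβ e =
  cong (F ∷_) (Fᵏ-prefix-before-U k xs ys β okx okβ (proj₂ (∷-injective e)))

isFᵏUℳD-++wrap : ∀ k ν m → mOK 0 ν ≡ true → isM m ≡ true → isFᵏUℳD k (ν ++ U ∷ m ++ D ∷ []) ≡ isFᵏ k ν
isFᵏUℳD-++wrap k ν m okν m∈ℳ = bool-≡ _ _ to from
  where
    FᵏU : List MStep
    FᵏU = replicate k F ++ U ∷ []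
    to : isFᵏUℳD k (ν ++ U ∷ m ++ D ∷ []) ≡ true → isFᵏ k ν ≡ true
    to e with wrapped-sound FᵏU (D ∷ []) (ν ++ U ∷ m ++ D ∷ []) e
    ... | β , e′ , β∈ℳ
      with Fᵏ-prefix-before-U k ν (m ++ D ∷ []) β okν (isM⇒mOK β β∈ℳ) (trans e′ (++-assoc (replicate k F) (U ∷ []) _))
    ... | refl = eqListM-refl ν
    from : isFᵏ k ν ≡ true → isFᵏUℳD k (ν ++ U ∷ m ++ D ∷ []) ≡ true
    from e with eqListM-sound (replicate k F) ν e
    ... | refl = subst (λ z → isFᵏUℳD k z ≡ true) (++-assoc (replicate k F) (U ∷ []) _)
                       (wrapped-complete FᵏU (D ∷ []) m m∈ℳ)

isUFᵏUℳDD-wrap : ∀ k m → isUFᵏUℳDD k (U ∷ m ++ D ∷ []) ≡ isFᵏUℳD k m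
isUFᵏUℳDD-wrap k m = bool-≡ _ _ to from
  where
    FᵏU : List MStep
    FᵏU = replicate k F ++ U ∷ []
    to : isUFᵏUℳDD k (U ∷ m ++ D ∷ []) ≡ true → isFᵏUℳD k m ≡ true
    to e with wrapped-sound (U ∷ FᵏU) (D ∷ D ∷ []) (U ∷ m ++ D ∷ []) e
    ... | β , e′ , β∈ℳ = subst (λ z → isFᵏUℳD k z ≡ true) (sym (proj₁ (∷ʳ-injective m (FᵏU ++ β ++ D ∷ []) mD≡)))
                                (wrapped-complete FᵏU (D ∷ []) β β∈ℳ)
      where
        mD≡ : m ++ D ∷ [] ≡ (FᵏU ++ β ++ D ∷ []) ++ D ∷ []
        mD≡ = trans (proj₂ (∷-injective e′))
                (trans (cong (FᵏU ++_) (sym (++-assoc β (D ∷ []) (D ∷ [])))) (sym (++-assoc FᵏU (β ++ D ∷ []) (D ∷ []))))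
    from : isFᵏUℳD k m ≡ true → isUFᵏUℳDD k (U ∷ m ++ D ∷ []) ≡ true
    from e with wrapped-sound FᵏU (D ∷ []) m e
    ... | β , refl , β∈ℳ = subst (λ z → isUFᵏUℳDD k (U ∷ z) ≡ true)
                                 (sym (trans (++-assoc FᵏU (β ++ D ∷ []) (D ∷ [])) (cong (FᵏU ++_) (++-assoc β (D ∷ []) (D ∷ [])))))
                                 (wrapped-complete (U ∷ FᵏU) (D ∷ D ∷ []) β β∈ℳ)

UʲDₘ : ℕ → ℕ → List AStep
UʲDₘ j m = replicate j up ++ dn m ∷ []

UᵏDₖ : ℕ → List AStep
UᵏDₖ k = UʲDₘ k k

isDown : AStep → Bool
isDown up     = false
isDown (dn _) = true

startsWith-sound : ∀ w xs → startsWith eqA w xs ≡ true → Σ (List AStep) λ r → xs ≡ w ++ r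
startsWith-sound []      xs       _ = xs , refl
startsWith-sound (a ∷ w) (x ∷ xs) e with ∧-true (eqA a x) _ e
... | a≈x , e′ with startsWith-sound w xs e′
... | r , refl = r , cong (_∷ (w ++ r)) (sym (eqA-sound a x a≈x))

startsWith-++ : ∀ w r → startsWith eqA w (w ++ r) ≡ true
startsWith-++ []      r = refl
startsWith-++ (a ∷ w) r rewrite eqA-refl a = startsWith-++ w r

heightA-++ : ∀ xs ys → heightA (xs ++ ys) ≡ heightA xs ℤ.+ heightA ys
heightA-++ []          ys = sym (ℤ.+-identityˡ _)
heightA-++ (up ∷ xs)   ys = trans (cong ℤ.suc (heightA-++ xs ys)) (sym (ℤ.+-assoc (+ 1) (heightA xs) (heightA ys)))
heightA-++ (dn k ∷ xs) ys =
  trans (cong (λ z → - (+ k) ℤ.+ z) (heightA-++ xs ys)) (sym (ℤ.+-assoc (- (+ k)) (heightA xs) (heightA ys)))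

i+j+[-i+x]≡j+x : ∀ (i j x : ℤ) → (i ℤ.+ j) ℤ.+ (- i ℤ.+ x) ≡ j ℤ.+ x
i+j+[-i+x]≡j+x = ℤ-Solver.solve-∀

height-after-dn : ∀ k h x → + (k + h) ℤ.+ (- (+ k) ℤ.+ x) ≡ + h ℤ.+ x
height-after-dn k h x =
  trans (cong (λ z → z ℤ.+ (- (+ k) ℤ.+ x)) (ℤ.pos-+ k h)) (i+j+[-i+x]≡j+x (+ k) (+ h) x)

apath-height : ∀ {h b α} → APath h b α → + h ℤ.+ heightA α ≡ + 0
apath-height done = refl
apath-height {h} (stepU {α = α} p)   = trans (sym (suc-i+j≡i+suc-j (+ h) (heightA α))) (apath-height p)
apath-height (stepD {h} {k} {α} _ p) = trans (height-after-dn k h (heightA α)) (apath-height p)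

isA-height : ∀ α → IsA α → heightA α ≡ + 0
isA-height α (p , _) = trans (sym (ℤ.+-identityˡ _)) (apath-height p)

apath-nil : ∀ {h b} → APath h b [] → h ≡ 0
apath-nil done = refl

apath-starts-up′ : ∀ {h b α} → APath h b α → h ≡ 0 → α ≢ [] → Σ (List AStep) λ α′ → α ≡ up ∷ α′
apath-starts-up′ done                _    α≢[] = ⊥-elim (α≢[] refl)
apath-starts-up′ (stepU {α = α} p)   _    _ = α , refl
apath-starts-up′ (stepD (s≤s z≤n) p) ()   _

apath-starts-up : ∀ {b α} → APath 0 b α → α ≢ [] → Σ (List AStep) λ α′ → α ≡ up ∷ α′
apath-starts-up p = apath-starts-up′ p refl

data EndsDown : List AStep → Set where
  endDown  : ∀ {k} → EndsDown (dn k ∷ [])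
  consDown : ∀ {x y ys} → EndsDown (y ∷ ys) → EndsDown (x ∷ y ∷ ys)

apath-endsDown : ∀ {h b α} → APath h b α → α ≢ [] → EndsDown α
apath-endsDown done                    α≢[] = ⊥-elim (α≢[] refl)
apath-endsDown (stepU {α = []} p)      _ with () ← apath-nil p
apath-endsDown (stepU {α = x ∷ α} p)   _ = consDown (apath-endsDown p (λ ()))
apath-endsDown (stepD {α = []} _ p)    _ = endDown
apath-endsDown (stepD {α = x ∷ α} _ p) _ = consDown (apath-endsDown p (λ ()))

isA-endsDown : ∀ α → IsA α → EndsDown α
isA-endsDown α (p , α≢[]) = apath-endsDown p α≢[]

startsWith-UʲDₘ-++ : ∀ j m s ys → EndsDown s → startsWith eqA (UʲDₘ j m) (s ++ ys) ≡ startsWith eqA (UʲDₘ j m) s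
startsWith-UʲDₘ-++ zero    m (x ∷ s)      ys _            = refl
startsWith-UʲDₘ-++ (suc j) m (up ∷ y ∷ s) ys (consDown d) = startsWith-UʲDₘ-++ j m (y ∷ s) ys d
startsWith-UʲDₘ-++ (suc j) m (dn k ∷ s)   ys _            = refl

eqList-UʲDₘ-++ : ∀ j m s ys → EndsDown s → ys ≢ [] → eqList eqA (UʲDₘ j m) (s ++ ys) ≡ false
eqList-UʲDₘ-++ zero    m (x ∷ [])     []       d            ys≢[] = ⊥-elim (ys≢[] refl)
eqList-UʲDₘ-++ zero    m (x ∷ [])     (y ∷ ys) d            _     = ∧-zeroʳ (eqA (dn m) x)
eqList-UʲDₘ-++ zero    m (x ∷ z ∷ s)  ys       d            _     = ∧-zeroʳ (eqA (dn m) x)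
eqList-UʲDₘ-++ (suc j) m (up ∷ y ∷ s) ys       (consDown d) ys≢[] = eqList-UʲDₘ-++ j m (y ∷ s) ys d ys≢[]
eqList-UʲDₘ-++ (suc j) m (dn k ∷ s)   ys       _            _     = refl

matches-UʲDₘ-++ : ∀ j m xs ys → EndsDown xs →
  matches eqA (UʲDₘ j m) (xs ++ ys) ≡ matches eqA (UʲDₘ j m) xs + matches eqA (UʲDₘ j m) ys
matches-UʲDₘ-++ j m (x ∷ []) ys endDown =
  trans (cong (λ b → toℕ b + matches eqA (UʲDₘ j m) ys) (startsWith-UʲDₘ-++ j m (x ∷ []) ys endDown))
        (cong (_+ matches eqA (UʲDₘ j m) ys) (sym (ℕ.+-identityʳ _)))
matches-UʲDₘ-++ j m (x ∷ y ∷ xs) ys (consDown d) =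
  trans (cong₂ _+_ (cong toℕ (startsWith-UʲDₘ-++ j m (x ∷ y ∷ xs) ys (consDown d))) (matches-UʲDₘ-++ j m (y ∷ xs) ys d))
        (sym (ℕ.+-assoc (toℕ (startsWith eqA (UʲDₘ j m) (x ∷ y ∷ xs))) _ _))

suffixMatches-UʲDₘ-++ : ∀ j m xs ys → EndsDown xs → ys ≢ [] →
  suffixMatches eqA (UʲDₘ j m) (xs ++ ys) ≡ suffixMatches eqA (UʲDₘ j m) ys
suffixMatches-UʲDₘ-++ j m (x ∷ [])     ys endDown      ys≢[] =
  cong (λ b → toℕ b + _) (eqList-UʲDₘ-++ j m (x ∷ []) ys endDown ys≢[])
suffixMatches-UʲDₘ-++ j m (x ∷ y ∷ xs) ys (consDown d) ys≢[] =
  trans (cong (λ b → toℕ b + _) (eqList-UʲDₘ-++ j m (x ∷ y ∷ xs) ys (consDown d) ys≢[]))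
        (suffixMatches-UʲDₘ-++ j m (y ∷ xs) ys d ys≢[])

suffixMatches-≡0 : {A : Set} (e : A → A → Bool) (w xs : List A) →
  (∀ r t → r ++ t ≡ xs → t ≢ [] → eqList e w t ≡ false) → suffixMatches e w xs ≡ 0
suffixMatches-≡0 e w []       h = refl
suffixMatches-≡0 e w (x ∷ xs) h rewrite h [] (x ∷ xs) refl (λ ()) =
  suffixMatches-≡0 e w xs (λ r t e′ t≢[] → h (x ∷ r) t (cong (x ∷_) e′) t≢[])

heightA-Uᵏ++ : ∀ k ys → heightA (replicate k up ++ ys) ≡ + k ℤ.+ heightA ys
heightA-Uᵏ++ zero    ys = sym (ℤ.+-identityˡ _)
heightA-Uᵏ++ (suc k) ys = trans (cong ℤ.suc (heightA-Uᵏ++ k ys)) (sym (ℤ.+-assoc (+ 1) (+ k) (heightA ys)))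

heightA-UᵏDₖ : ∀ k → heightA (UᵏDₖ k) ≡ + 0
heightA-UᵏDₖ k = trans (heightA-Uᵏ++ k (dn k ∷ [])) (cancel (+ k))
  where
    cancel : ∀ i → i ℤ.+ (- i ℤ.+ + 0) ≡ + 0
    cancel = ℤ-Solver.solve-∀

heightA-++-≡0 : ∀ p q → heightA (p ++ q) ≡ + 0 → heightA q ≡ + 0 → heightA p ≡ + 0
heightA-++-≡0 p q hpq hq = begin
  heightA p                      ≡⟨ ℤ.+-identityʳ (heightA p) ⟨
  heightA p ℤ.+ + 0              ≡⟨ cong (λ z → heightA p ℤ.+ z) hq ⟨
  heightA p ℤ.+ heightA q        ≡⟨ heightA-++ p q ⟨
  heightA (p ++ q)               ≡⟨ hpq ⟩
  + 0                            ∎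
  where open ≡-Reasoning

UᵏDₖ≢[] : ∀ k → UᵏDₖ k ≢ []
UᵏDₖ≢[] zero    ()
UᵏDₖ≢[] (suc k) ()

endsWithDk≥2-view : ∀ α → EndsWithDk≥2 α → Σ (List AStep) λ s → Σ ℕ λ j → (α ≡ s ++ dn j ∷ []) × 2 ≤ j
endsWithDk≥2-view (dn k ∷ [])  (endHere 2≤k) = [] , k , refl , 2≤k
endsWithDk≥2-view (x ∷ y ∷ ys) (endLater e) with endsWithDk≥2-view (y ∷ ys) e
... | s , j , eq , 2≤j = x ∷ s , j , cong (x ∷_) eq , 2≤j

prime-view : ∀ α → IsP α → Σ (List AStep) λ s → Σ ℕ λ j → (α ≡ up ∷ s ++ dn j ∷ []) × 2 ≤ j
prime-view α ((p , α≢[]) , ends , _) with endsWithDk≥2-view α ends | apath-starts-up p α≢[]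
... | []    , j , refl , 2≤j | _ , ()
... | x ∷ s , j , refl , 2≤j | _ , eq with ∷-injective eq
... | refl , _ = s , j , refl , 2≤j

decLast-∷ʳ : ∀ s j → decLast (s ++ dn j ∷ []) ≡ s ++ dn (j ∸ 1) ∷ []
decLast-∷ʳ []             j = refl
decLast-∷ʳ (up ∷ [])      j = refl
decLast-∷ʳ (dn k ∷ [])    j = refl
decLast-∷ʳ (up ∷ y ∷ s)   j = cong (up ∷_) (decLast-∷ʳ (y ∷ s) j)
decLast-∷ʳ (dn k ∷ y ∷ s) j = cong (dn k ∷_) (decLast-∷ʳ (y ∷ s) j)

lower-view : ∀ s j → lower (up ∷ s ++ dn j ∷ []) ≡ s ++ dn (j ∸ 1) ∷ []
lower-view = decLast-∷ʳ

prime-no-return : ∀ α → IsP α → ∀ p q → α ≡ p ++ q → p ≢ [] → q ≢ [] → heightA p ≢ + 0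
prime-no-return α (_ , _ , no-return) = no-return

startsWith-UᵏDₖ-prime : ∀ k α → IsP α → startsWith eqA (UᵏDₖ k) α ≡ eqList eqA (UᵏDₖ k) α
startsWith-UᵏDₖ-prime k α α-prime = bool-≡ _ _ to from
  where
    to : startsWith eqA (UᵏDₖ k) α ≡ true → eqList eqA (UᵏDₖ k) α ≡ true
    to e with startsWith-sound (UᵏDₖ k) α e
    ... | []    , eq = trans (cong (eqList eqA (UᵏDₖ k)) (trans eq (++-identityʳ (UᵏDₖ k)))) (eqListA-refl (UᵏDₖ k))
    ... | x ∷ r , eq = ⊥-elim (prime-no-return α α-prime (UᵏDₖ k) (x ∷ r) eq (UᵏDₖ≢[] k) (λ ()) (heightA-UᵏDₖ k))
    from : eqList eqA (UᵏDₖ k) α ≡ true → startsWith eqA (UᵏDₖ k) α ≡ true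
    from e with eqListA-sound (UᵏDₖ k) α e
    ... | refl = trans (cong (startsWith eqA (UᵏDₖ k)) (sym (++-identityʳ (UᵏDₖ k)))) (startsWith-++ (UᵏDₖ k) [])

suffixMatches-UᵏDₖ-prime : ∀ k s → IsP (up ∷ s) → suffixMatches eqA (UᵏDₖ k) s ≡ 0
suffixMatches-UᵏDₖ-prime k s s-prime = suffixMatches-≡0 eqA (UᵏDₖ k) s not-suffix
  where
    not-suffix : ∀ r t → r ++ t ≡ s → t ≢ [] → eqList eqA (UᵏDₖ k) t ≡ false
    not-suffix r t e t≢[] with eqList eqA (UᵏDₖ k) t in eq
    ... | false = refl
    ... | true with eqListA-sound (UᵏDₖ k) t eq
    ... | refl = ⊥-elim (prime-no-return (up ∷ s) s-prime (up ∷ r) (UᵏDₖ k) (cong (up ∷_) (sym e)) (λ ()) t≢[]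
                   (heightA-++-≡0 (up ∷ r) (UᵏDₖ k)
                     (trans (cong heightA (cong (up ∷_) e)) (isA-height _ (proj₁ s-prime))) (heightA-UᵏDₖ k)))

SLast-++ : ∀ xs y ys → SLast (xs ++ y ∷ ys) ≡ SLast (y ∷ ys)
SLast-++ []            y ys = refl
SLast-++ (up ∷ [])     y ys = refl
SLast-++ (dn k ∷ [])   y ys = refl
SLast-++ (up ∷ z ∷ xs)   y ys = SLast-++ (z ∷ xs) y ys
SLast-++ (dn k ∷ z ∷ xs) y ys = SLast-++ (z ∷ xs) y ys

isZero-≢ : ∀ z → z ≢ + 0 → isZero z ≡ false
isZero-≢ (+ zero)  z≢0 = ⊥-elim (z≢0 refl)
isZero-≢ (+ suc n) _   = refl
isZero-≢ -[1+ n ]  _   = refl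

module Returns {A : Set} (height : List A → ℤ)
               (height-++ : ∀ xs ys → height (xs ++ ys) ≡ height xs ℤ.+ height ys) where

  isReturn : List A → Bool
  isReturn p = nonEmpty p ∧ isZero (height p)

  returns-++ : ∀ β γ → height β ≡ + 0 →
    prefixCount isReturn (β ++ γ) ≡ prefixCount isReturn β + prefixCount isReturn γ
  returns-++ β γ hβ = trans (prefixCount-++ isReturn β γ) (cong (_+_ (prefixCount isReturn β)) (prefixCount-cong _ isReturn γ shift))
    where
      shift : ∀ y t → isReturn (β ++ y ∷ t) ≡ isReturn (y ∷ t)
      shift y t rewrite nonEmpty-++-∷ β y t | height-++ β (y ∷ t) | hβ | ℤ.+-identityˡ (height (y ∷ t)) = refl

  returns-irreducible : ∀ y ys → height (y ∷ ys) ≡ + 0 →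
    (∀ p q → y ∷ ys ≡ p ++ q → p ≢ [] → q ≢ [] → height p ≢ + 0) → prefixCount isReturn (y ∷ ys) ≡ 1
  returns-irreducible y ys h no-return =
    trans (prefixCount-whole isReturn y ys (λ x t u e u≢[] → isZero-≢ _ (no-return (x ∷ t) u (sym e) (λ ()) u≢[])))
          (cong (λ z → toℕ (isZero z)) h)

open Returns heightA heightA-++ using () renaming (isReturn to isReturnA; returns-++ to returnsA-++)
open Returns heightM heightM-++ using () renaming (isReturn to isReturnM; returns-++ to returnsM-++;
                                                   returns-irreducible to returnsM-irreducible)

returnsA-prime : ∀ γ → IsP γ → prefixCount isReturnA γ ≡ 1
returnsA-prime γ γ-prime with prime-view γ γ-prime
... | s , j , refl , _ = Returns.returns-irreducible heightA heightA-++ up (s ++ dn j ∷ [])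
                           (isA-height _ (proj₁ γ-prime)) (prime-no-return _ γ-prime)

returnsM-wrap : ∀ m → mOK 0 m ≡ true → prefixCount isReturnM (U ∷ m ++ D ∷ []) ≡ 1
returnsM-wrap m ok = returnsM-irreducible U (m ++ D ∷ []) (primitive-height _ UmD-primitive) no-return
  where
    UmD-primitive : Primitive (U ∷ m ++ D ∷ [])
    UmD-primitive = m , refl , ok
    no-return : ∀ p q → U ∷ m ++ D ∷ [] ≡ p ++ q → p ≢ [] → q ≢ [] → heightM p ≢ + 0
    no-return p q e p≢[] q≢[] hp with primitive-prefix-height _ p q UmD-primitive e p≢[] q≢[]
    ... | n , hp′ with trans (sym hp) hp′
    ... | ()

-- lastFgo i last s is the position of the last F of s when s is numbered from i, or last if s has no F
lastFgo-shift : ∀ ys i j last → lastFgo (j + i) (j + last) ys ≡ j + lastFgo i last ys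
lastFgo-shift []       i j last = refl
lastFgo-shift (F ∷ ys) i j last = trans (cong (λ z → lastFgo z (j + i) ys) (sym (ℕ.+-suc j i))) (lastFgo-shift ys (suc i) j i)
lastFgo-shift (U ∷ ys) i j last = trans (cong (λ z → lastFgo z (j + last) ys) (sym (ℕ.+-suc j i))) (lastFgo-shift ys (suc i) j last)
lastFgo-shift (D ∷ ys) i j last = trans (cong (λ z → lastFgo z (j + last) ys) (sym (ℕ.+-suc j i))) (lastFgo-shift ys (suc i) j last)

lastFgo-last : ∀ {ys} → F ∈ ys → ∀ i last last′ → lastFgo i last ys ≡ lastFgo i last′ ys
lastFgo-last {F ∷ ys} _          i last last′ = refl
lastFgo-last {U ∷ ys} (there F∈) i last last′ = lastFgo-last F∈ (suc i) last last′
lastFgo-last {D ∷ ys} (there F∈) i last last′ = lastFgo-last F∈ (suc i) last last′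

lastFgo-++ : ∀ xs ys i last → lastFgo i last (xs ++ ys) ≡ lastFgo (length xs + i) (lastFgo i last xs) ys
lastFgo-++ []       ys i last = refl
lastFgo-++ (F ∷ xs) ys i last =
  trans (lastFgo-++ xs ys (suc i) i) (cong (λ z → lastFgo z (lastFgo (suc i) i xs) ys) (ℕ.+-suc (length xs) i))
lastFgo-++ (U ∷ xs) ys i last =
  trans (lastFgo-++ xs ys (suc i) last) (cong (λ z → lastFgo z (lastFgo (suc i) last xs) ys) (ℕ.+-suc (length xs) i))
lastFgo-++ (D ∷ xs) ys i last =
  trans (lastFgo-++ xs ys (suc i) last) (cong (λ z → lastFgo z (lastFgo (suc i) last xs) ys) (ℕ.+-suc (length xs) i))

LastF-++ : ∀ xs ys → F ∈ ys → LastF (xs ++ ys) ≡ length xs + LastF ys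
LastF-++ xs ys F∈ys = trans (lastFgo-++ xs ys 1 0)
  (trans (lastFgo-last F∈ys (length xs + 1) _ (length xs + 0)) (lastFgo-shift ys 1 (length xs) 0))

LastF-wrap : ∀ m → F ∈ m → LastF (U ∷ m ++ D ∷ []) ≡ suc (LastF m)
LastF-wrap m F∈m = trans (lastFgo-++ m (D ∷ []) 2 0) (trans (lastFgo-last F∈m 2 0 1) (lastFgo-shift m 1 1 0))

Δ-formula : ℕ → List MStep → ℕ
Δ-formula k μ = toℕ (isFᵏ (suc k) μ) + countF (isUFᵏD (suc k)) μ + toℕ (isFᵏUℳD k μ) + countF (isUFᵏUℳDD k) μ

-- The fields whole-UᵏDₖ and suffix-UᵏDₖ are what make matches-UᵏDₖ inductive: lowering a
-- prime changes its last step, hence exactly the occurrences of Uᵏ⁺¹ Dₖ₊₁ that end there.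
record Invariant (α : List AStep) (μ : List MStep) : Set where
  field
    μ∈ℳ           : isM μ ≡ true
    F∈μ           : F ∈ μ
    length-α      : length α ≡ suc (length μ)
    ups           : count (eqA up) α ≡ count (eqM F) μ + count (eqM U) μ
    Us≡Ds         : count (eqM U) μ ≡ count (eqM D) μ
    downs         : count isDown α ≡ suc (count (eqM U) μ)
    returns+LastF : prefixCount isReturnA α + LastF μ ≡ length α
    SLast≡returns : SLast α ≡ prefixCount isReturnM μ
    whole-UᵏDₖ    : ∀ k → toℕ (eqList eqA (UᵏDₖ (suc k)) α) ≡ toℕ (isFᵏ (suc k) μ)
    suffix-UᵏDₖ   : ∀ k → suffixMatches eqA (UᵏDₖ (suc k)) α ≡ toℕ (isFᵏ (suc k) μ) + toℕ (isFᵏUℳD k μ)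
    matches-UᵏDₖ  : ∀ k → matches eqA (UᵏDₖ (suc k)) α ≡ Δ-formula k μ

open Invariant

invariant-UD : Invariant (up ∷ dn 1 ∷ []) (F ∷ [])
μ∈ℳ           invariant-UD = refl
F∈μ           invariant-UD = here refl
length-α      invariant-UD = refl
ups           invariant-UD = refl
Us≡Ds         invariant-UD = refl
downs         invariant-UD = refl
returns+LastF invariant-UD = refl
SLast≡returns invariant-UD = refl
whole-UᵏDₖ    invariant-UD zero          = refl
whole-UᵏDₖ    invariant-UD (suc k)       = refl
suffix-UᵏDₖ   invariant-UD zero          = refl
suffix-UᵏDₖ   invariant-UD (suc zero)    = refl
suffix-UᵏDₖ   invariant-UD (suc (suc k)) = refl
matches-UᵏDₖ  invariant-UD zero          = refl
matches-UᵏDₖ  invariant-UD (suc zero)    = refl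
matches-UᵏDₖ  invariant-UD (suc (suc k)) = refl

count-wrap : ∀ p m → count p (U ∷ m ++ D ∷ []) ≡ toℕ (p U) + (count p m + (toℕ (p D) + 0))
count-wrap p m = trans (count-∷ p U _) (cong (_+_ (toℕ (p U))) (trans (count-++ p m (D ∷ [])) (cong (_+_ (count p m)) (count-∷ p D []))))

length-wrap : ∀ m → length (U ∷ m ++ D ∷ []) ≡ suc (length m + 1)
length-wrap m = cong suc (length-++ m)

invariant-βUD : ∀ β m → IsA β → Invariant β m → Invariant (β ++ up ∷ dn 1 ∷ []) (U ∷ m ++ D ∷ [])
invariant-βUD β m β∈𝒜 I = record
  { μ∈ℳ           = isM-wrap m (μ∈ℳ I)
  ; F∈μ           = there (∈-++⁺ˡ (F∈μ I))
  ; length-α      = trans (length-++ β) (trans (cong (_+ 2) (length-α I))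
                      (cong suc (trans (ℕ.+-suc (length m) 1) (cong suc (sym (length-++ m))))))
  ; ups           = trans (count-++ (eqA up) β _) (trans (cong (_+ 1) (ups I))
                      (trans (arith₁ (count (eqM F) m) (count (eqM U) m))
                        (sym (cong₂ _+_ (count-wrap (eqM F) m) (count-wrap (eqM U) m)))))
  ; Us≡Ds         = trans (count-wrap (eqM U) m) (trans (cong (λ z → 1 + (z + 0)) (Us≡Ds I))
                      (trans (arith₂ (count (eqM D) m)) (sym (count-wrap (eqM D) m))))
  ; downs         = trans (count-++ isDown β _) (trans (cong (_+ 1) (downs I))
                      (trans (arith₃ (count (eqM U) m)) (cong suc (sym (count-wrap (eqM U) m)))))
  ; returns+LastF = trans (cong₂ _+_ (returnsA-++ β _ (isA-height β β∈𝒜)) (LastF-wrap m (F∈μ I)))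
                      (trans (arith₄ (prefixCount isReturnA β) (LastF m))
                        (trans (cong (_+ 2) (returns+LastF I)) (sym (length-++ β))))
  ; SLast≡returns = trans (SLast-++ β up (dn 1 ∷ [])) (sym (returnsM-wrap m m-motzkin))
  ; whole-UᵏDₖ    = λ k → trans (cong toℕ (eqList-UʲDₘ-++ (suc k) (suc k) β _ β-endsDown (λ ())))
                            (sym (cong toℕ (isFᵏ-wrap (suc k) m)))
  ; suffix-UᵏDₖ   = λ k → trans (suffixMatches-UʲDₘ-++ (suc k) (suc k) β _ β-endsDown (λ ())) (suffix-UD k)
  ; matches-UᵏDₖ  = λ k → trans (matches-UʲDₘ-++ (suc k) (suc k) β _ β-endsDown)
                            (trans (cong (_+ matches eqA (UᵏDₖ (suc k)) (up ∷ dn 1 ∷ [])) (matches-UᵏDₖ I k)) (Δ-wrap k))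
  }
  where
    β-endsDown : EndsDown β
    β-endsDown = isA-endsDown β β∈𝒜
    m-motzkin : mOK 0 m ≡ true
    m-motzkin  = isM⇒mOK m (μ∈ℳ I)
    arith₁ : ∀ a b → (a + b) + 1 ≡ (0 + (a + (0 + 0))) + (1 + (b + (0 + 0)))
    arith₁ = solve-∀
    arith₂ : ∀ a → 1 + (a + 0) ≡ 0 + (a + (1 + 0))
    arith₂ = solve-∀
    arith₃ : ∀ a → suc a + 1 ≡ suc (1 + (a + (0 + 0)))
    arith₃ = solve-∀
    arith₄ : ∀ a b → (a + 1) + suc b ≡ (a + b) + 2
    arith₄ = solve-∀
    -- the new U D is the only occurrence of U D at the end, and U m D ∈ U ℳ D
    suffix-UD : ∀ k → suffixMatches eqA (UᵏDₖ (suc k)) (up ∷ dn 1 ∷ [])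
                      ≡ toℕ (isFᵏ (suc k) (U ∷ m ++ D ∷ [])) + toℕ (isFᵏUℳD k (U ∷ m ++ D ∷ []))
    suffix-UD zero    rewrite isF⁰UℳD-wrap m (μ∈ℳ I) = refl
    suffix-UD (suc k) rewrite isFᵏ⁺¹UℳD-wrap k m     = refl
    matches-UD : ∀ k → matches eqA (UᵏDₖ (suc k)) (up ∷ dn 1 ∷ []) ≡ toℕ (isFᵏUℳD k (U ∷ m ++ D ∷ []))
    matches-UD zero    rewrite isF⁰UℳD-wrap m (μ∈ℳ I) = refl
    matches-UD (suc k) rewrite isFᵏ⁺¹UℳD-wrap k m     = refl
    Δ-wrap : ∀ k → Δ-formula k m + matches eqA (UᵏDₖ (suc k)) (up ∷ dn 1 ∷ []) ≡ Δ-formula k (U ∷ m ++ D ∷ [])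
    Δ-wrap k rewrite matches-UD k | isFᵏ-wrap (suc k) m
                   | countF-wrap (isUFᵏD (suc k)) (isUFᵏD-primitive (suc k)) m m-motzkin
                   | countF-wrap (isUFᵏUℳDD k) (isUFᵏUℳDD-primitive k) m m-motzkin
                   | isUFᵏD-wrap (suc k) m | isUFᵏUℳDD-wrap k m
      = arith (toℕ (isFᵏ (suc k) m)) (countF (isUFᵏD (suc k)) m) (toℕ (isFᵏUℳD k m))
              (countF (isUFᵏUℳDD k) m) (toℕ (isFᵏUℳD k (U ∷ m ++ D ∷ [])))
      where
        arith : ∀ a b c d e → (a + b + c + d) + e ≡ 0 + (b + a) + e + (d + c)
        arith = solve-∀

module LoweredPrime (s : List AStep) (j : ℕ) (ν : List MStep)
                    (γ-prime : IsP (up ∷ s ++ dn (suc (suc j)) ∷ []))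
                    (I : Invariant (s ++ dn (suc j) ∷ []) ν) where

  γ : List AStep
  γ = up ∷ s ++ dn (suc (suc j)) ∷ []

  whole-γ : ∀ k → toℕ (eqList eqA (UᵏDₖ (suc k)) γ) ≡ toℕ (isFᵏ k ν)
  whole-γ zero    = trans (cong toℕ (trans (eqList-∷ʳ eqA [] s (dn 1) (dn (suc (suc j)))) (∧-zeroʳ (eqList eqA [] s))))
                          (sym (cong toℕ (isF⁰-nonEmpty ν (isM⇒≢[] ν (μ∈ℳ I)))))
  whole-γ (suc k) = trans (cong toℕ (eqList-∷ʳ eqA (replicate (suc k) up) s (dn (suc (suc k))) (dn (suc (suc j)))))
                          (trans (cong toℕ (sym (eqList-∷ʳ eqA (replicate (suc k) up) s (dn (suc k)) (dn (suc j)))))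
                                 (whole-UᵏDₖ I k))

  suffix-γ : ∀ k → suffixMatches eqA (UᵏDₖ (suc k)) γ ≡ toℕ (isFᵏ k ν)
  suffix-γ k = trans (cong (_+_ (toℕ (eqList eqA (UᵏDₖ (suc k)) γ))) (suffixMatches-UᵏDₖ-prime (suc k) _ γ-prime))
                     (trans (ℕ.+-identityʳ _) (whole-γ k))

  matches-s : ∀ k → matches eqA (UᵏDₖ (suc k)) s ≡ countF (isUFᵏD (suc k)) ν + countF (isUFᵏUℳDD k) ν
  matches-s k = ℕ.+-cancelˡ-≡ (A + B) _ _ (begin
    (A + B) + matches eqA (UᵏDₖ (suc k)) s
      ≡⟨ ℕ.+-comm (A + B) _ ⟩
    matches eqA (UᵏDₖ (suc k)) s + (A + B)
      ≡⟨ cong (_+_ (matches eqA (UᵏDₖ (suc k)) s)) (suffix-UᵏDₖ I k) ⟨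
    matches eqA (UᵏDₖ (suc k)) s + suffixMatches eqA (UᵏDₖ (suc k)) (s ++ dn (suc j) ∷ [])
      ≡⟨ matches-∷ʳ eqA up (replicate k up ++ dn (suc k) ∷ []) s (dn (suc j)) ⟨
    matches eqA (UᵏDₖ (suc k)) (s ++ dn (suc j) ∷ [])
      ≡⟨ matches-UᵏDₖ I k ⟩
    A + c₁ + B + c₂
      ≡⟨ arith A c₁ B c₂ ⟩
    (A + B) + (c₁ + c₂) ∎)
    where
      open ≡-Reasoning
      A B c₁ c₂ : ℕ
      A  = toℕ (isFᵏ (suc k) ν)
      B  = toℕ (isFᵏUℳD k ν)
      c₁ = countF (isUFᵏD (suc k)) ν
      c₂ = countF (isUFᵏUℳDD k) ν
      arith : ∀ a c b d → a + c + b + d ≡ (a + b) + (c + d)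
      arith = solve-∀

  matches-γ : ∀ k → matches eqA (UᵏDₖ (suc k)) γ ≡ toℕ (isFᵏ k ν) + (countF (isUFᵏD (suc k)) ν + countF (isUFᵏUℳDD k) ν)
  matches-γ k = cong₂ _+_ (trans (cong toℕ (startsWith-UᵏDₖ-prime (suc k) γ γ-prime)) (whole-γ k))
    (trans (matches-∷ʳ eqA up (replicate k up ++ dn (suc k) ∷ []) s (dn (suc (suc j))))
      (trans (cong (_+_ (matches eqA (UᵏDₖ (suc k)) s)) (suffixMatches-UᵏDₖ-prime (suc k) _ γ-prime))
        (trans (ℕ.+-identityʳ _) (matches-s k))))

  count-γ : ∀ p → count p γ ≡ toℕ (p up) + (count p s + (toℕ (p (dn (suc (suc j)))) + 0))
  count-γ p = trans (count-∷ p up _) (cong (_+_ (toℕ (p up))) (trans (count-++ p s _) (cong (_+_ (count p s)) (count-∷ p _ []))))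

  count-lowered : ∀ p → count p (s ++ dn (suc j) ∷ []) ≡ count p s + (toℕ (p (dn (suc j))) + 0)
  count-lowered p = trans (count-++ p s _) (cong (_+_ (count p s)) (count-∷ p _ []))

  length-γ : length γ ≡ suc (suc (length ν))
  length-γ = cong suc (trans (length-++ s) (trans (sym (length-++ s)) (length-α I)))

  SLast-γ : SLast γ ≡ suc (suc j)
  SLast-γ = SLast-++ (up ∷ s) (dn (suc (suc j))) []

  returns-ν : prefixCount isReturnM ν ≡ suc j
  returns-ν = trans (sym (SLast≡returns I)) (SLast-++ s (dn (suc j)) [])

  ups-γ : count (eqA up) γ ≡ suc (count (eqM F) ν + count (eqM U) ν)
  ups-γ = trans (count-γ (eqA up)) (cong suc (trans (sym (count-lowered (eqA up))) (ups I)))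

  downs-γ : count isDown γ ≡ suc (count (eqM U) ν)
  downs-γ = trans (count-γ isDown) (trans (ℕ.+-identityˡ _) (trans (sym (count-lowered isDown)) (downs I)))

invariant-P : ∀ α ν → IsP α → Invariant (lower α) ν → Invariant α (ν ++ F ∷ [])
invariant-P α ν α-prime I♭ with prime-view α α-prime
... | s , suc (suc j) , refl , s≤s (s≤s z≤n) = record
  { μ∈ℳ           = isM-∷ʳF ν (μ∈ℳ I)
  ; F∈μ           = ∈-++⁺ʳ ν (here refl)
  ; length-α      = trans length-γ (cong suc (trans (cong suc (sym (ℕ.+-identityʳ _)))
                      (trans (sym (ℕ.+-suc (length ν) 0)) (sym (length-++ ν)))))
  ; ups           = trans ups-γ (trans (arith₁ (count (eqM F) ν) (count (eqM U) ν))
                      (sym (cong₂ _+_ (count-++ (eqM F) ν (F ∷ [])) (count-++ (eqM U) ν (F ∷ [])))))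
  ; Us≡Ds         = trans (count-++ (eqM U) ν (F ∷ [])) (trans (cong (_+ 0) (Us≡Ds I)) (sym (count-++ (eqM D) ν (F ∷ []))))
  ; downs         = trans downs-γ (cong suc (trans (sym (ℕ.+-identityʳ _)) (sym (count-++ (eqM U) ν (F ∷ [])))))
  ; returns+LastF = trans (cong₂ _+_ (returnsA-prime γ α-prime) (LastF-++ ν (F ∷ []) (here refl)))
                      (trans (arith₂ (length ν)) (sym length-γ))
  ; SLast≡returns = trans SLast-γ (trans (cong suc (sym returns-ν))
                      (trans (ℕ.+-comm 1 _) (sym (returnsM-++ ν (F ∷ []) (motzkin-height ν ν-motzkin)))))
  ; whole-UᵏDₖ    = λ k → trans (whole-γ k) (sym (cong toℕ (isFᵏ⁺¹-∷ʳF k ν)))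
  ; suffix-UᵏDₖ   = λ k → trans (suffix-γ k) (trans (sym (ℕ.+-identityʳ _))
                            (sym (cong₂ _+_ (cong toℕ (isFᵏ⁺¹-∷ʳF k ν)) (cong toℕ (isFᵏUℳD-∷ʳF k ν)))))
  ; matches-UᵏDₖ  = λ k → trans (matches-γ k) (sym (Δ-∷ʳF k))
  }
  where
    I : Invariant (s ++ dn (suc j) ∷ []) ν
    I = subst (λ z → Invariant z ν) (lower-view s (suc (suc j))) I♭
    open LoweredPrime s j ν α-prime I
    ν-motzkin : mOK 0 ν ≡ true
    ν-motzkin = isM⇒mOK ν (μ∈ℳ I)
    arith₁ : ∀ a b → suc (a + b) ≡ (a + 1) + (b + 0)
    arith₁ = solve-∀
    arith₂ : ∀ a → 1 + (a + 1) ≡ suc (suc a)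
    arith₂ = solve-∀
    Δ-∷ʳF : ∀ k → Δ-formula k (ν ++ F ∷ []) ≡ toℕ (isFᵏ k ν) + (countF (isUFᵏD (suc k)) ν + countF (isUFᵏUℳDD k) ν)
    Δ-∷ʳF k rewrite isFᵏ⁺¹-∷ʳF k ν | isFᵏUℳD-∷ʳF k ν
                  | countF-∷ʳF (isUFᵏD (suc k)) (isUFᵏD-primitive (suc k)) ν
                  | countF-∷ʳF (isUFᵏUℳDD k) (isUFᵏUℳDD-primitive k) ν
      = arith (toℕ (isFᵏ k ν)) (countF (isUFᵏD (suc k)) ν) (countF (isUFᵏUℳDD k) ν)
      where
        arith : ∀ a b c → a + b + 0 + c ≡ a + (b + c)
        arith = solve-∀

invariant-βγ : ∀ β γ m ν → IsA β → IsP γ → Invariant β m → Invariant (lower γ) ν →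
  Invariant (β ++ γ) (ν ++ U ∷ m ++ D ∷ [])
invariant-βγ β γ m ν β∈𝒜 γ-prime Iβ I♭ with prime-view γ γ-prime
... | s , suc (suc j) , refl , s≤s (s≤s z≤n) = record
  { μ∈ℳ           = isM-++wrap ν m (μ∈ℳ I) (μ∈ℳ Iβ)
  ; F∈μ           = ∈-++⁺ʳ ν (there (∈-++⁺ˡ (F∈μ Iβ)))
  ; length-α      = trans (length-++ β) (trans (cong₂ _+_ (length-α Iβ) length-γ)
                      (trans (arith₀ (length m) (length ν))
                        (cong suc (sym (trans (length-++ ν) (cong (_+_ (length ν)) (length-wrap m)))))))
  ; ups           = trans (count-++ (eqA up) β γ) (trans (cong₂ _+_ (ups Iβ) ups-γ)
                      (trans (arith₁ (count (eqM F) m) (count (eqM U) m) (count (eqM F) ν) (count (eqM U) ν))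
                        (sym (cong₂ _+_ (count-++wrap (eqM F)) (count-++wrap (eqM U))))))
  ; Us≡Ds         = trans (count-++wrap (eqM U))
                      (trans (cong₂ (λ a b → a + (1 + (b + 0))) (Us≡Ds I) (Us≡Ds Iβ))
                        (trans (arith₂ (count (eqM D) ν) (count (eqM D) m)) (sym (count-++wrap (eqM D)))))
  ; downs         = trans (count-++ isDown β γ) (trans (cong₂ _+_ (downs Iβ) downs-γ)
                      (trans (arith₃ (count (eqM U) m) (count (eqM U) ν)) (cong suc (sym (count-++wrap (eqM U))))))
  ; returns+LastF = returns+LastF-βγ
  ; SLast≡returns = trans (SLast-++ β up _) (trans SLast-γ (trans (cong suc (sym returns-ν)) (trans (ℕ.+-comm 1 _)
                      (sym (trans (returnsM-++ ν _ (motzkin-height ν ν-motzkin))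
                                  (cong (_+_ (prefixCount isReturnM ν)) (returnsM-wrap m m-motzkin)))))))
  ; whole-UᵏDₖ    = λ k → trans (cong toℕ (eqList-UʲDₘ-++ (suc k) (suc k) β γ β-endsDown (λ ())))
                            (sym (cong toℕ (isFᵏ-++wrap (suc k) ν m)))
  ; suffix-UᵏDₖ   = λ k → trans (suffixMatches-UʲDₘ-++ (suc k) (suc k) β γ β-endsDown (λ ())) (trans (suffix-γ k)
                            (sym (cong₂ _+_ (cong toℕ (isFᵏ-++wrap (suc k) ν m))
                                            (cong toℕ (isFᵏUℳD-++wrap k ν m ν-motzkin (μ∈ℳ Iβ))))))
  ; matches-UᵏDₖ  = λ k → trans (matches-UʲDₘ-++ (suc k) (suc k) β γ β-endsDown)
                            (trans (cong₂ _+_ (matches-UᵏDₖ Iβ k) (matches-γ k)) (sym (Δ-++wrap k)))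
  }
  where
    I : Invariant (s ++ dn (suc j) ∷ []) ν
    I = subst (λ z → Invariant z ν) (lower-view s (suc (suc j))) I♭
    open LoweredPrime s j ν γ-prime I hiding (γ)
    ν-motzkin : mOK 0 ν ≡ true
    ν-motzkin  = isM⇒mOK ν (μ∈ℳ I)
    m-motzkin : mOK 0 m ≡ true
    m-motzkin  = isM⇒mOK m (μ∈ℳ Iβ)
    β-endsDown : EndsDown β
    β-endsDown = isA-endsDown β β∈𝒜
    count-++wrap : ∀ p → count p (ν ++ U ∷ m ++ D ∷ []) ≡ count p ν + (toℕ (p U) + (count p m + (toℕ (p D) + 0)))
    count-++wrap p = trans (count-++ p ν _) (cong (_+_ (count p ν)) (count-wrap p m))
    arith₀ : ∀ a b → suc a + suc (suc b) ≡ suc (b + suc (a + 1))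
    arith₀ = solve-∀
    arith₁ : ∀ a b c d → (a + b) + suc (c + d) ≡ (c + (0 + (a + (0 + 0)))) + (d + (1 + (b + (0 + 0))))
    arith₁ = solve-∀
    arith₂ : ∀ a b → a + (1 + (b + 0)) ≡ a + (0 + (b + (1 + 0)))
    arith₂ = solve-∀
    arith₃ : ∀ a b → suc a + suc b ≡ suc (b + (1 + (a + (0 + 0))))
    arith₃ = solve-∀
    returns+LastF-βγ : prefixCount isReturnA (β ++ γ) + LastF (ν ++ U ∷ m ++ D ∷ []) ≡ length (β ++ γ)
    returns+LastF-βγ = begin
      prefixCount isReturnA (β ++ γ) + LastF (ν ++ U ∷ m ++ D ∷ [])
        ≡⟨ cong₂ _+_ (trans (returnsA-++ β γ (isA-height β β∈𝒜)) (cong (_+_ (prefixCount isReturnA β)) (returnsA-prime γ γ-prime)))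
                     (trans (LastF-++ ν _ (there (∈-++⁺ˡ (F∈μ Iβ)))) (cong (_+_ (length ν)) (LastF-wrap m (F∈μ Iβ)))) ⟩
      (prefixCount isReturnA β + 1) + (length ν + suc (LastF m))
        ≡⟨ arith (prefixCount isReturnA β) (LastF m) (length ν) ⟩
      (prefixCount isReturnA β + LastF m) + suc (suc (length ν))
        ≡⟨ cong₂ _+_ (returns+LastF Iβ) (sym length-γ) ⟩
      length β + length γ
        ≡⟨ length-++ β ⟨
      length (β ++ γ) ∎
      where
        open ≡-Reasoning
        arith : ∀ a b c → (a + 1) + (c + suc b) ≡ (a + b) + suc (suc c)
        arith = solve-∀
    Δ-++wrap : ∀ k → Δ-formula k (ν ++ U ∷ m ++ D ∷ [])
                     ≡ Δ-formula k m + (toℕ (isFᵏ k ν) + (countF (isUFᵏD (suc k)) ν + countF (isUFᵏUℳDD k) ν))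
    Δ-++wrap k rewrite isFᵏ-++wrap (suc k) ν m | isFᵏUℳD-++wrap k ν m ν-motzkin (μ∈ℳ Iβ)
                     | countF-++wrap (isUFᵏD (suc k)) (isUFᵏD-primitive (suc k)) ν m m-motzkin
                     | countF-++wrap (isUFᵏUℳDD k) (isUFᵏUℳDD-primitive k) ν m m-motzkin
                     | countF-wrap (isUFᵏD (suc k)) (isUFᵏD-primitive (suc k)) m m-motzkin
                     | countF-wrap (isUFᵏUℳDD k) (isUFᵏUℳDD-primitive k) m m-motzkin
                     | isUFᵏD-wrap (suc k) m | isUFᵏUℳDD-wrap k m
      = arith (toℕ (isFᵏ (suc k) m)) (countF (isUFᵏD (suc k)) m) (toℕ (isFᵏUℳD k m)) (countF (isUFᵏUℳDD k) m)
              (toℕ (isFᵏ k ν)) (countF (isUFᵏD (suc k)) ν) (countF (isUFᵏUℳDD k) ν)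
      where
        arith : ∀ a b c d e f g → 0 + (f + (b + a)) + e + (g + (d + c)) ≡ (a + b + c + d) + (e + (f + g))
        arith = solve-∀

Ψ⇒invariant : ∀ α μ → Ψ α μ → Invariant α μ
Ψ⇒invariant _ _ ψ-UD                                 = invariant-UD
Ψ⇒invariant _ _ (ψ-βUD {β} {μ} β∈𝒜 ψβ)               = invariant-βUD β μ β∈𝒜 (Ψ⇒invariant _ _ ψβ)
Ψ⇒invariant α _ (ψ-P {ν = ν} α-prime ψ♭)            = invariant-P α ν α-prime (Ψ⇒invariant _ _ ψ♭)
Ψ⇒invariant _ _ (ψ-βγ {β} {γ} {μ} {ν} β∈𝒜 γ-prime ψβ ψ♭) =
  invariant-βγ β γ μ ν β∈𝒜 γ-prime (Ψ⇒invariant _ _ ψβ) (Ψ⇒invariant _ _ ψ♭)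

-- Every α ∈ 𝒜 has an image under ψ

NoReturn : ℕ → List AStep → Set
NoReturn h α = ∀ p q → α ≡ p ++ q → p ≢ [] → q ≢ [] → + h ℤ.+ heightA p ≢ + 0

Block : List AStep → Set
Block γ = IsA γ × NoReturn 0 γ

apath-after-dn : ∀ {h α} → APath h true α → APath h false α
apath-after-dn done      = done
apath-after-dn (stepU p) = stepU p

+h+1≢0 : ∀ h → + h ℤ.+ + 1 ≢ + 0
+h+1≢0 zero    ()
+h+1≢0 (suc h) ()

split-last-block : ∀ {h b α} → APath h b α → α ≢ [] →
  NoReturn h α ⊎ Σ (List AStep) λ β → Σ (List AStep) λ γ → (α ≡ β ++ γ) × (β ≢ []) × APath h b β × Block γ
split-last-block done α≢[] = ⊥-elim (α≢[] refl)
split-last-block {h} (stepU {α = α} p) _ with α | p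
... | []    | p′ with () ← apath-nil p′
... | x ∷ α′ | p′ with split-last-block p′ (λ ())
...   | inj₂ (β , γ , e , β≢[] , pβ , γ-block) = inj₂ (up ∷ β , γ , cong (up ∷_) e , (λ ()) , stepU pβ , γ-block)
...   | inj₁ no-return = inj₁ no-return′
  where
    no-return′ : NoReturn h (up ∷ x ∷ α′)
    no-return′ []           q e p≢[] _ _ = p≢[] refl
    no-return′ (up ∷ [])    q e _ _      = +h+1≢0 h
    no-return′ (up ∷ y ∷ r) q e _ q≢[] hz =
      no-return (y ∷ r) q (proj₂ (∷-injective e)) (λ ()) q≢[] (trans (suc-i+j≡i+suc-j (+ h) (heightA (y ∷ r))) hz)
split-last-block (stepD {h} {k} {α} 1≤k p) _ with α
... | [] = inj₁ no-return
  where
    no-return : NoReturn (k + h) (dn k ∷ [])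
    no-return []           q       e  p≢[] _    _ = p≢[] refl
    no-return (x ∷ [])     []      e  _    q≢[] _ = q≢[] refl
    no-return (x ∷ [])     (y ∷ q) () _    _    _
    no-return (x ∷ z ∷ r)  q       () _    _    _
... | y ∷ α′ with split-last-block p (λ ())
...   | inj₂ (β , γ , e , β≢[] , pβ , γ-block) = inj₂ (dn k ∷ β , γ , cong (dn k ∷_) e , (λ ()) , stepD 1≤k pβ , γ-block)
...   | inj₁ no-return with h
...     | zero    = inj₂ (dn k ∷ [] , y ∷ α′ , refl , (λ ()) , stepD 1≤k done , (apath-after-dn p , (λ ())) , no-return)
...     | suc h′  = inj₁ no-return′
  where
    no-return′ : NoReturn (k + suc h′) (dn k ∷ y ∷ α′)
    no-return′ [] q e p≢[] _ _ = p≢[] refl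
    no-return′ (dn k′ ∷ []) q e _ _ hz with ∷-injective e
    ... | refl , _ with trans (sym (trans (height-after-dn k (suc h′) (+ 0)) (ℤ.+-identityʳ (+ suc h′)))) hz
    ... | ()
    no-return′ (dn k′ ∷ z ∷ r) q e _ q≢[] hz with ∷-injective e
    ... | refl , e′ = no-return (z ∷ r) q e′ (λ ()) q≢[] (trans (sym (height-after-dn k (suc h′) (heightA (z ∷ r)))) hz)

last-block : ∀ α → IsA α →
  Σ (List AStep) λ β → Σ (List AStep) λ γ → (α ≡ β ++ γ) × ((β ≡ []) ⊎ IsA β) × Block γ
last-block α (p , α≢[]) with split-last-block p α≢[]
... | inj₁ no-return = [] , α , refl , inj₁ refl , ((p , α≢[]) , no-return)
... | inj₂ (β , γ , e , β≢[] , pβ , γ-block) = β , γ , e , inj₂ (pβ , β≢[]) , γ-block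

∷ʳ-view : {A : Set} (s : List A) → s ≢ [] → Σ (List A) λ s′ → Σ A λ x → s ≡ s′ ++ x ∷ []
∷ʳ-view []          s≢[] = ⊥-elim (s≢[] refl)
∷ʳ-view (x ∷ [])    _    = [] , x , refl
∷ʳ-view (x ∷ y ∷ s) _ with ∷ʳ-view (y ∷ s) (λ ())
... | s′ , z , e = x ∷ s′ , z , cong (x ∷_) e

endsDown-view : ∀ {α} → EndsDown α → Σ (List AStep) λ s → Σ ℕ λ j → α ≡ s ++ dn j ∷ []
endsDown-view (endDown {k}) = [] , k , refl
endsDown-view (consDown {x} d) with endsDown-view d
... | s , j , e = x ∷ s , j , cong (x ∷_) e

apath-last-dn : ∀ {h b} s j → APath h b (s ++ dn j ∷ []) → 1 ≤ j
apath-last-dn []         j (stepD 1≤j done) = 1≤j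
apath-last-dn (up ∷ s)   j (stepU p)        = apath-last-dn s j p
apath-last-dn (dn k ∷ s) j (stepD _ p)      = apath-last-dn s j p

apath-no-dndn : ∀ {h b} s a c → APath h b (s ++ dn a ∷ dn c ∷ []) → ⊥
apath-no-dndn []         a c (stepD _ ())
apath-no-dndn (up ∷ s)   a c (stepU p)   = apath-no-dndn s a c p
apath-no-dndn (dn k ∷ s) a c (stepD _ p) = apath-no-dndn s a c p

endsWithDk≥2-intro : ∀ s j → 2 ≤ j → EndsWithDk≥2 (s ++ dn j ∷ [])
endsWithDk≥2-intro []          j 2≤j = endHere 2≤j
endsWithDk≥2-intro (x ∷ [])    j 2≤j = endLater (endHere 2≤j)
endsWithDk≥2-intro (x ∷ y ∷ s) j 2≤j = endLater (endsWithDk≥2-intro (y ∷ s) j 2≤j)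

block-no-return : ∀ γ → NoReturn 0 γ → ∀ p q → γ ≡ p ++ q → p ≢ [] → q ≢ [] → heightA p ≢ + 0
block-no-return γ no-return p q e p≢[] q≢[] hz = no-return p q e p≢[] q≢[] (trans (ℤ.+-identityˡ (heightA p)) hz)

-- a block ending in D₁ must end in U D₁, and an earlier return is excluded
block-classify : ∀ γ → Block γ → (γ ≡ up ∷ dn 1 ∷ []) ⊎ IsP γ
block-classify γ ((p , γ≢[]) , no-return) with endsDown-view (apath-endsDown p γ≢[])
... | s , j , γ≡ with apath-last-dn s j (subst (APath 0 false) γ≡ p)
... | 1≤j with j
...   | suc (suc j′) = inj₂ ((p , γ≢[]) , subst EndsWithDk≥2 (sym γ≡) (endsWithDk≥2-intro s _ (s≤s (s≤s z≤n)))
                              , block-no-return γ no-return)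
...   | suc zero with s | γ≡
...     | [] | e with apath-starts-up p γ≢[]
...       | _ , e′ with trans (sym e) e′
...         | ()
block-classify γ ((p , γ≢[]) , no-return) | s , j , _ | _ | suc zero | x ∷ s₁ | e with ∷ʳ-view (x ∷ s₁) (λ ())
... | s′ , dn a , e′ = ⊥-elim (apath-no-dndn s′ a 1 (subst (APath 0 false) γ≡ p))
  where
    γ≡ : γ ≡ s′ ++ dn a ∷ dn 1 ∷ []
    γ≡ = trans e (trans (cong (_++ dn 1 ∷ []) e′) (++-assoc s′ (dn a ∷ []) (dn 1 ∷ [])))
... | []       , up , e′ = inj₁ (trans e (cong (_++ dn 1 ∷ []) e′))
... | (y ∷ s″) , up , e′ = ⊥-elim (block-no-return γ no-return (y ∷ s″) (up ∷ dn 1 ∷ []) γ≡ (λ ()) (λ ())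
                             (heightA-++-≡0 (y ∷ s″) (up ∷ dn 1 ∷ []) (trans (cong heightA (sym γ≡)) (isA-height γ (p , γ≢[]))) refl))
  where
    γ≡ : γ ≡ (y ∷ s″) ++ up ∷ dn 1 ∷ []
    γ≡ = trans e (trans (cong (_++ dn 1 ∷ []) e′) (++-assoc (y ∷ s″) (up ∷ []) (dn 1 ∷ [])))

lowered-apath : ∀ {H b} h s j → APath H b (s ++ dn (suc (suc j)) ∷ []) → H ≡ suc h →
  (∀ p q → s ≡ p ++ q → + suc h ℤ.+ heightA p ≢ + 0) → APath h b (s ++ dn (suc j) ∷ [])
lowered-apath h [] j (stepD _ done) H≡ _ =
  subst (λ z → APath z false (dn (suc j) ∷ [])) (ℕ.suc-injective H≡) (stepD (s≤s z≤n) done)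
lowered-apath h (up ∷ s) j (stepU p) H≡ above = stepU (lowered-apath (suc h) s j p (cong suc H≡)
  (λ p′ q e hz → above (up ∷ p′) q (cong (up ∷_) e) (trans (sym (suc-i+j≡i+suc-j (+ suc h) (heightA p′))) hz)))
lowered-apath h (dn k ∷ s) j (stepD {h′} 1≤k p) H≡ above with h′
... | zero = ⊥-elim (above (dn k ∷ []) s refl
                      (trans (cong (λ z → + z ℤ.+ (- (+ k) ℤ.+ + 0)) (sym H≡)) (trans (height-after-dn k 0 (+ 0)) refl)))
... | suc h″ = subst (λ z → APath z false (dn k ∷ s ++ dn (suc j) ∷ [])) k+h″≡h
    (stepD 1≤k (lowered-apath h″ s j p refl (λ p′ q e hz → above (dn k ∷ p′) q (cong (dn k ∷_) e)
      (trans (cong (λ z → + z ℤ.+ (- (+ k) ℤ.+ heightA p′)) (sym H≡)) (trans (height-after-dn k (suc h″) (heightA p′)) hz)))))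
  where
    k+h″≡h : k + h″ ≡ h
    k+h″≡h = ℕ.suc-injective (trans (sym (ℕ.+-suc k h″)) H≡)

isA-lower : ∀ γ → IsP γ → IsA (lower γ)
isA-lower γ γ-prime with prime-view γ γ-prime
... | s , suc (suc j) , refl , s≤s (s≤s z≤n) with proj₁ γ-prime
... | stepU p , _ = subst IsA (sym (lower-view s (suc (suc j)))) (lowered-apath 0 s j p refl above , ∷ʳ≢[] s)
  where
    ∷ʳ≢[] : ∀ {x} r → r ++ x ∷ [] ≢ []
    ∷ʳ≢[] []      ()
    ∷ʳ≢[] (_ ∷ _) ()
    above : ∀ p q → s ≡ p ++ q → + 1 ℤ.+ heightA p ≢ + 0
    above p q e = prime-no-return _ γ-prime (up ∷ p) (q ++ dn (suc (suc j)) ∷ [])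
                    (cong (up ∷_) (trans (cong (_++ dn (suc (suc j)) ∷ []) e) (++-assoc p q _))) (λ ()) (∷ʳ≢[] q)

length-lower : ∀ γ → IsP γ → suc (length (lower γ)) ≡ length γ
length-lower γ γ-prime with prime-view γ γ-prime
... | s , j , refl , _ = cong suc (trans (cong length (lower-view s j)) (trans (length-++ s) (sym (length-++ s))))

length-<-++ : ∀ (β γ : List AStep) → γ ≢ [] → length β < length (β ++ γ)
length-<-++ β []      γ≢[] = ⊥-elim (γ≢[] refl)
length-<-++ β (x ∷ γ) _    = subst (length β <_) (sym (length-++ β)) (ℕ.m<m+n (length β) (s≤s z≤n))

length-lower-< : ∀ β γ → IsP γ → length (lower γ) < length (β ++ γ)
length-lower-< β γ γ-prime =
  ℕ.<-≤-trans (subst (length (lower γ) <_) (length-lower γ γ-prime) (ℕ.n<1+n _)) (length-++-≤ʳ γ {β})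

prime-≢[] : ∀ γ → IsP γ → γ ≢ []
prime-≢[] γ ((_ , γ≢[]) , _) = γ≢[]

Ψ-total-acc : ∀ α → Acc _<_ (length α) → IsA α → Σ (List MStep) (Ψ α)
Ψ-total-acc α (acc rs) α∈𝒜 with last-block α α∈𝒜
... | β , γ , refl , β-cases , γ-block with block-classify γ γ-block
...   | inj₁ refl with β-cases
...     | inj₁ refl = F ∷ [] , ψ-UD
...     | inj₂ β∈𝒜 with Ψ-total-acc β (rs (length-<-++ β _ (λ ()))) β∈𝒜
...       | μ , ψβ = U ∷ μ ++ D ∷ [] , ψ-βUD β∈𝒜 ψβ
Ψ-total-acc _ (acc rs) _ | β , γ , refl , β-cases , _ | inj₂ γ-prime
  with Ψ-total-acc (lower γ) (rs (length-lower-< β γ γ-prime)) (isA-lower γ γ-prime)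
... | ν , ψ♭ with β-cases
...   | inj₁ refl = ν ++ F ∷ [] , ψ-P γ-prime ψ♭
...   | inj₂ β∈𝒜 with Ψ-total-acc β (rs (length-<-++ β γ (prime-≢[] γ γ-prime))) β∈𝒜
...     | μ , ψβ = ν ++ U ∷ μ ++ D ∷ [] , ψ-βγ β∈𝒜 γ-prime ψβ ψ♭

Ψ-total : ∀ α → IsA α → Σ (List MStep) (Ψ α)
Ψ-total α = Ψ-total-acc α (<-wellFounded (length α))

apath-start : ∀ {h α} → APath h false α → h ≡ 0 → APath 0 true α
apath-start done                _  = done
apath-start (stepU p)           refl = stepU p
apath-start (stepD (s≤s z≤n) p) ()

apath-tail-up : ∀ {h b α} → APath h b (up ∷ α) → APath (suc h) false α
apath-tail-up (stepU p) = p

apath-tail-dn : ∀ {h b k α} → APath h b (dn k ∷ α) → Σ ℕ λ h′ → APath h′ true α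
apath-tail-dn (stepD _ p) = _ , p

apath-dn-pos : ∀ {h b k α} → APath h b (dn k ∷ α) → 1 ≤ k
apath-dn-pos (stepD 1≤k _) = 1≤k

apath-dn-dn : ∀ {h k α} → APath h true (dn k ∷ α) → ⊥
apath-dn-dn ()

-- In the following, a path is read after a down-step (or at the start), so it is a
-- sequence of blocks Uᵃ Dₖ: each of its down-steps is preceded by a U.

matches-D≡matches-UD : ∀ {h} α → APath h true α → matches eqA (dn 1 ∷ []) α ≡ matches eqA (up ∷ dn 1 ∷ []) α
matches-D≡matches-UD []              _ = refl
matches-D≡matches-UD (up ∷ [])       p with () ← apath-nil (apath-tail-up p)
matches-D≡matches-UD (up ∷ up ∷ α)   p = matches-D≡matches-UD (up ∷ α) (stepU (apath-tail-up (apath-tail-up p)))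
matches-D≡matches-UD (up ∷ dn k ∷ α) p =
  cong (_+_ (toℕ (eqA (dn 1) (dn k) ∧ true))) (matches-D≡matches-UD α (proj₂ (apath-tail-dn (apath-tail-up p))))

matches-DU+suffix-UD : ∀ {h} α → APath h true α →
  matches eqA (dn 1 ∷ up ∷ []) α + suffixMatches eqA (up ∷ dn 1 ∷ []) α ≡ matches eqA (up ∷ dn 1 ∷ []) α
matches-DU+suffix-UD []        _ = refl
matches-DU+suffix-UD (up ∷ []) p with () ← apath-nil (apath-tail-up p)
matches-DU+suffix-UD (up ∷ up ∷ α) p = matches-DU+suffix-UD (up ∷ α) (stepU (apath-tail-up (apath-tail-up p)))
matches-DU+suffix-UD (up ∷ dn zero ∷ α) p with () ← apath-dn-pos (apath-tail-up p)
matches-DU+suffix-UD (up ∷ dn (suc k) ∷ dn j ∷ α) p = ⊥-elim (apath-dn-dn (proj₂ (apath-tail-dn (apath-tail-up p))))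
matches-DU+suffix-UD (up ∷ dn (suc zero) ∷ [])    p = refl
matches-DU+suffix-UD (up ∷ dn (suc (suc k)) ∷ []) p = refl
matches-DU+suffix-UD (up ∷ dn (suc zero) ∷ up ∷ α) p =
  cong suc (matches-DU+suffix-UD (up ∷ α) (proj₂ (apath-tail-dn (apath-tail-up p))))
matches-DU+suffix-UD (up ∷ dn (suc (suc k)) ∷ up ∷ α) p =
  matches-DU+suffix-UD (up ∷ α) (proj₂ (apath-tail-dn (apath-tail-up p)))

matches-UU+downs : ∀ {h} α → APath h true α → matches eqA (up ∷ up ∷ []) α + count isDown α ≡ count (eqA up) α
matches-UU+downs []              _ = refl
matches-UU+downs (up ∷ [])       p with () ← apath-nil (apath-tail-up p)
matches-UU+downs (up ∷ up ∷ α)   p = cong suc (matches-UU+downs (up ∷ α) (stepU (apath-tail-up (apath-tail-up p))))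
matches-UU+downs (up ∷ dn k ∷ α) p = trans (ℕ.+-suc (matches eqA (up ∷ up ∷ []) α) (count isDown α))
  (cong suc (matches-UU+downs α (proj₂ (apath-tail-dn (apath-tail-up p)))))

peaks≡downs : ∀ {h} α → APath h true α → countF isUDj α ≡ count isDown α
peaks≡downs []        _ = refl
peaks≡downs (up ∷ []) p with () ← apath-nil (apath-tail-up p)
peaks≡downs (up ∷ up ∷ α) p = trans (countF-∷ isUDj up (up ∷ α) refl)
  (trans (cong (_+ countF isUDj (up ∷ α)) (prefixCount-false α)) (peaks≡downs (up ∷ α) (stepU (apath-tail-up (apath-tail-up p)))))
peaks≡downs (up ∷ dn zero ∷ α) p with () ← apath-dn-pos (apath-tail-up p)
peaks≡downs (up ∷ dn (suc k) ∷ α) p = trans (countF-∷ isUDj up (dn (suc k) ∷ α) refl)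
  (trans (cong₂ _+_ (cong suc (trans (prefixCount-cong _ (λ _ → false) α (λ _ _ → refl)) (prefixCount-false α)))
                    (trans (countF-∷ isUDj (dn (suc k)) α refl) (cong (_+ countF isUDj α) (prefixCount-false α))))
         (cong suc (peaks≡downs α (proj₂ (apath-tail-dn (apath-tail-up p))))))

module Statistics {α μ} (I : Invariant α μ) (α-path : APath 0 true α) where

  occA-[_] : ∀ a → occA (a ∷ []) α ≡ count (eqA a) α
  occA-[ a ] = trans (countF-eqList eqA a [] α) (matches-singleton eqA a α)

  occM-[_] : ∀ a → occM (a ∷ []) μ ≡ count (eqM a) μ
  occM-[ a ] = trans (countF-eqList eqM a [] μ) (matches-singleton eqM a μ)

  Δ-formula≡ : ∀ k → ind (replicate (suc k) F) μ + occM (U ∷ replicate (suc k) F ++ D ∷ []) μ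
                      + indWrapped (replicate k F ++ U ∷ []) (D ∷ []) μ
                      + occWrapped (U ∷ replicate k F ++ U ∷ []) (D ∷ D ∷ []) μ ≡ Δ-formula k μ
  Δ-formula≡ k = cong₂ (λ a b → a + countF (isUFᵏD (suc k)) μ + b + countF (isUFᵏUℳDD k) μ)
                   (ind≡toℕ (replicate (suc k) F) μ) (indWrapped≡toℕ (replicate k F ++ U ∷ []) (D ∷ []) μ)

  ups≡F+U : occA (up ∷ []) α ≡ occM (F ∷ []) μ + occM (U ∷ []) μ
  ups≡F+U = trans occA-[ up ] (trans (ups I) (sym (cong₂ _+_ occM-[ F ] occM-[ U ])))

  F+U≡F+D : occM (F ∷ []) μ + occM (U ∷ []) μ ≡ occM (F ∷ []) μ + occM (D ∷ []) μ
  F+U≡F+D = cong (_+_ (occM (F ∷ []) μ)) (trans occM-[ U ] (trans (Us≡Ds I) (sym occM-[ D ])))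

  D≡UD : occA (dn 1 ∷ []) α ≡ occA (up ∷ dn 1 ∷ []) α
  D≡UD = trans (countF-eqList eqA (dn 1) [] α)
           (trans (matches-D≡matches-UD α α-path) (sym (countF-eqList eqA up (dn 1 ∷ []) α)))

  Δ≡ : ∀ k → Δ (suc k) α ≡ ind (replicate (suc k) F) μ + occM (U ∷ replicate (suc k) F ++ D ∷ []) μ
                           + indWrapped (replicate k F ++ U ∷ []) (D ∷ []) μ
                           + occWrapped (U ∷ replicate k F ++ U ∷ []) (D ∷ D ∷ []) μ
  Δ≡ k = trans (countF-eqList eqA up (replicate k up ++ dn (suc k) ∷ []) α)
            (trans (matches-UᵏDₖ I k) (sym (Δ-formula≡ k)))

  -- a D U is a U D not at the end, and the U D at the end is counted by the two indicators
  DU≡ : occA (dn 1 ∷ up ∷ []) α ≡ occM (U ∷ F ∷ D ∷ []) μ + occWrapped (U ∷ U ∷ []) (D ∷ D ∷ []) μ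
  DU≡ = trans (countF-eqList eqA (dn 1) (up ∷ []) α) (ℕ.+-cancelˡ-≡ (A + B) X (c₁ + c₂) (begin
    (A + B) + X                                           ≡⟨ ℕ.+-comm (A + B) X ⟩
    X + (A + B)                                           ≡⟨ cong (_+_ X) (suffix-UᵏDₖ I 0) ⟨
    X + suffixMatches eqA (up ∷ dn 1 ∷ []) α              ≡⟨ matches-DU+suffix-UD α α-path ⟩
    matches eqA (up ∷ dn 1 ∷ []) α                        ≡⟨ matches-UᵏDₖ I 0 ⟩
    A + c₁ + B + c₂                                       ≡⟨ arith A B c₁ c₂ ⟩
    (A + B) + (c₁ + c₂)                                   ∎))
    where
      open ≡-Reasoning
      A B c₁ c₂ X : ℕ
      A  = toℕ (isFᵏ 1 μ)
      B  = toℕ (isFᵏUℳD 0 μ)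
      c₁ = countF (isUFᵏD 1) μ
      c₂ = countF (isUFᵏUℳDD 0) μ
      X  = matches eqA (dn 1 ∷ up ∷ []) α
      arith : ∀ a b c d → a + c + b + d ≡ (a + b) + (c + d)
      arith = solve-∀

  UU+1≡F : occA (up ∷ up ∷ []) α + 1 ≡ occM (F ∷ []) μ
  UU+1≡F = trans (cong (_+ 1) (countF-eqList eqA up (up ∷ []) α)) (trans (ℕ.+-cancelʳ-≡ cU (UU + 1) cF (begin
    (UU + 1) + cU              ≡⟨ arith UU cU ⟩
    UU + suc cU                ≡⟨ cong (_+_ UU) (downs I) ⟨
    UU + count isDown α        ≡⟨ matches-UU+downs α α-path ⟩
    count (eqA up) α           ≡⟨ ups I ⟩
    cF + cU                    ∎)) (sym occM-[ F ]))
    where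
      open ≡-Reasoning
      UU cF cU : ℕ
      UU = matches eqA (up ∷ up ∷ []) α
      cF = count (eqM F) μ
      cU = count (eqM U) μ
      arith : ∀ a b → (a + 1) + b ≡ a + suc b
      arith = solve-∀

  Peak≡U+1 : Peak α ≡ occM (U ∷ []) μ + 1
  Peak≡U+1 = trans (peaks≡downs α α-path) (trans (downs I) (trans (ℕ.+-comm 1 _) (cong (_+ 1) (sym occM-[ U ]))))

  RetA≡length∸LastF : RetA α ≡ length α ∸ LastF μ
  RetA≡length∸LastF = begin
    RetA α                                      ≡⟨ count-inits isReturnA α ⟩
    prefixCount isReturnA α                     ≡⟨ ℕ.m+n∸n≡m (prefixCount isReturnA α) (LastF μ) ⟨
    prefixCount isReturnA α + LastF μ ∸ LastF μ ≡⟨ cong (_∸ LastF μ) (returns+LastF I) ⟩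
    length α ∸ LastF μ                          ∎
    where open ≡-Reasoning

  SLast≡RetM : SLast α ≡ RetM μ
  SLast≡RetM = trans (SLast≡returns I) (sym (count-inits isReturnM μ))

proposition1 : (n : ℕ) → 2 ≤ n → (α : List AStep) → IsAn n α →
  Σ (List MStep) (λ μ → Ψ α μ) ×
  ((μ : List MStep) → Ψ α μ →
      (occA (up ∷ []) α ≡ occM (F ∷ []) μ + occM (U ∷ []) μ
        × occM (F ∷ []) μ + occM (U ∷ []) μ ≡ occM (F ∷ []) μ + occM (D ∷ []) μ)
    × (occA (dn 1 ∷ []) α ≡ occA (up ∷ dn 1 ∷ []) α
        × occA (up ∷ dn 1 ∷ []) α ≡ ind (F ∷ []) μ + occM (U ∷ F ∷ D ∷ []) μ
            + indWrapped (U ∷ []) (D ∷ []) μ + occWrapped (U ∷ U ∷ []) (D ∷ D ∷ []) μ)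
    × (occA (dn 1 ∷ up ∷ []) α ≡ occM (U ∷ F ∷ D ∷ []) μ + occWrapped (U ∷ U ∷ []) (D ∷ D ∷ []) μ)
    × (occA (up ∷ up ∷ []) α + 1 ≡ occM (F ∷ []) μ)
    × ((k : ℕ) → 1 ≤ k →
        Δ k α ≡ ind (replicate k F) μ + occM (U ∷ replicate k F ++ D ∷ []) μ
          + indWrapped (replicate (k ∸ 1) F ++ U ∷ []) (D ∷ []) μ
          + occWrapped (U ∷ replicate (k ∸ 1) F ++ U ∷ []) (D ∷ D ∷ []) μ)
    × (Peak α ≡ occM (U ∷ []) μ + 1)
    × (RetA α ≡ n ∸ LastF μ)
    × (SLast α ≡ RetM μ))
proposition1 n _ α (α∈𝒜 , refl) = Ψ-total α α∈𝒜 , λ μ ψ →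
  let open Statistics (Ψ⇒invariant α μ ψ) (apath-start (proj₁ α∈𝒜) refl)
  in (ups≡F+U , F+U≡F+D) , (D≡UD , Δ≡ 0) , DU≡ , UU+1≡F
     , (λ { (suc k) _ → Δ≡ k }) , Peak≡U+1 , RetA≡length∸LastF , SLast≡RetM
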